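{- Let $\mathcal O$ be a discrete valuation ring with residue field of characteristic $p$, let $p\geq m$, and let $R$ be an $\mathcal O$-algebra. Let $J\in\mathrm{GL}_m(R)$ be the matrix of a perfect symmetric or alternating pairing on $R^m$. Let $A\in\mathrm{Mat}_m(R)$ have characteristic polynomial $x^m$ and let $B=\exp(A)$. Then $A^TJ+JA=0$ if and only if $B^TJB=J$.
   Context: For $A$ with characteristic polynomial $x^m$, $\exp(A)=1+A+A^2/2+\dots+A^{m-1}/(m-1)!$ (the denominators are invertible since $p\geq m$). -}

module Defs where

open import Level using (Level; _⊔_)
open import Data.Nat using (ℕ; zero; suc; _∸_; _≟_)
open import Data.Nat using (_!)
open import Data.Fin using (Fin; zero; suc; toℕ; punchIn)
open import Data.Bool using (if_then_else_)
open import Data.Product using (Σ; ∃; ∃-syntax; _×_; _,_)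
open import Data.Sum using (_⊎_)
open import Relation.Nullary using (¬_)
open import Relation.Nullary.Decidable using (⌊_⌋)
open import Data.Fin.Properties using () renaming (_≟_ to _≟F_)
open import Algebra.Bundles using (CommutativeRing; RawRing)
open import Algebra.Morphism.Structures using (module RingMorphisms)

module _ {a ℓ} (R : RawRing a ℓ) where
  open RawRing R

  ∑ : ∀ {n} → (Fin n → Carrier) → Carrier
  ∑ {zero}  f = 0#
  ∑ {suc n} f = f zero + ∑ (λ i → f (suc i))

  fromℕ : ℕ → Carrier
  fromℕ zero    = 0#
  fromℕ (suc n) = 1# + fromℕ n

  sgn : ℕ → Carrier
  sgn zero    = 1#
  sgn (suc k) = - sgn k

  det : ∀ {n} → (Fin n → Fin n → Carrier) → Carrier
  det {zero}  M = 1#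
  det {suc n} M = ∑ (λ j → (sgn (toℕ j) * M zero j) * det (λ i k → M (suc i) (punchIn j k)))

-- Formal power series over a commutative ring, as coefficient sequences.
-- Polynomials R[x] embed injectively (as a ring) into these, so computing the
-- characteristic polynomial here gives the same coefficients.

module Over {c ℓ} (R : CommutativeRing c ℓ) where
  open CommutativeRing R

  private rR = CommutativeRing.rawRing R

  PowSeries : RawRing c ℓ
  PowSeries = record
    { Carrier = ℕ → Carrier
    ; _≈_ = λ f g → ∀ n → f n ≈ g n
    ; _+_ = λ f g n → f n + g n
    ; _*_ = λ f g n → ∑ rR {suc n} (λ i → f (toℕ i) * g (n ∸ toℕ i))
    ; -_  = λ f n → - f n
    ; 0#  = λ _ → 0#
    ; 1#  = λ n → if ⌊ n ≟ 0 ⌋ then 1# else 0#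
    }

  X : ℕ → Carrier
  X n = if ⌊ n ≟ 1 ⌋ then 1# else 0#

  const : Carrier → ℕ → Carrier
  const r n = if ⌊ n ≟ 0 ⌋ then r else 0#

  IsUnit : Carrier → Set (c ⊔ ℓ)
  IsUnit x = ∃[ y ] (x * y ≈ 1#)

  Mat : ℕ → Set c
  Mat m = Fin m → Fin m → Carrier

  _≈M_ : ∀ {m} → Mat m → Mat m → Set ℓ
  A ≈M B = ∀ i j → A i j ≈ B i j

  _+M_ : ∀ {m} → Mat m → Mat m → Mat m
  (A +M B) i j = A i j + B i j

  _*M_ : ∀ {m} → Mat m → Mat m → Mat m
  (A *M B) i j = ∑ rR (λ k → A i k * B k j)

  _·M_ : ∀ {m} → Carrier → Mat m → Mat m
  (r ·M A) i j = r * A i j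

  0M : ∀ {m} → Mat m
  0M i j = 0#

  1M : ∀ {m} → Mat m
  1M i j = if ⌊ i ≟F j ⌋ then 1# else 0#

  _ᵀ : ∀ {m} → Mat m → Mat m
  (A ᵀ) i j = A j i

  _^M_ : ∀ {m} → Mat m → ℕ → Mat m
  A ^M zero  = 1M
  A ^M suc k = A *M (A ^M k)

  ∑M : ∀ {m n} → (Fin n → Mat m) → Mat m
  ∑M F i j = ∑ rR (λ k → F k i j)

  charPoly : ∀ {m} → Mat m → ℕ → Carrier
  charPoly A = det PowSeries (λ i j →
    λ n → (if ⌊ i ≟F j ⌋ then X n else 0#) - const (A i j) n)

  CharPolyIsXPow : ∀ {m} → Mat m → Set ℓ
  CharPolyIsXPow {m} A = ∀ n → charPoly A n ≈ (if ⌊ n ≟ m ⌋ then 1# else 0#)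

  -- B = exp(A) = Σ_{k<m} A^k / k!  (truncated at m; the factorials k!, k < m,
  -- are inverted in R).  u k is the inverse of k! in R.
  IsExpOf : ∀ {m} → Mat m → Mat m → Set (c ⊔ ℓ)
  IsExpOf {m} A B =
    Σ (Fin m → Carrier) λ u →
      (∀ k → u k * fromℕ rR (toℕ k !) ≈ 1#) ×
      (B ≈M ∑M (λ k → u k ·M (A ^M toℕ k)))

  pairing : ∀ {m} → Mat m → (Fin m → Carrier) → (Fin m → Carrier) → Carrier
  pairing J v w = ∑ rR (λ i → ∑ rR (λ j → (v i * J i j) * w j))

  IsSymmetricPairing : ∀ {m} → Mat m → Set (c ⊔ ℓ)
  IsSymmetricPairing J = ∀ v w → pairing J v w ≈ pairing J w v

  IsAlternatingPairing : ∀ {m} → Mat m → Set (c ⊔ ℓ)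
  IsAlternatingPairing J = ∀ v → pairing J v v ≈ 0#

  -- J ∈ GL_m(R)  (i.e. the pairing is perfect)
  IsInvertible : ∀ {m} → Mat m → Set (c ⊔ ℓ)
  IsInvertible {m} J = Σ (Mat m) λ J' → (J *M J') ≈M 1M × (J' *M J) ≈M 1M

  _^_ : Carrier → ℕ → Carrier
  x ^ zero  = 1#
  x ^ suc n = x * (x ^ n)

  record IsDVR : Set (c ⊔ ℓ) where
    field
      nontrivial      : ¬ (1# ≈ 0#)
      noZeroDivisors  : ∀ x y → x * y ≈ 0# → x ≈ 0# ⊎ y ≈ 0#
      π               : Carrier
      π-nonzero       : ¬ (π ≈ 0#)
      π-nonunit       : ¬ IsUnit π
      factor          : ∀ x → ¬ (x ≈ 0#) →
                        ∃[ n ] ∃[ u ] (IsUnit u × x ≈ u * (π ^ n))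

  -- the residue field O/𝔪 (𝔪 = non-units) has characteristic p, for p prime:
  -- p·1 lies in the maximal ideal.
  ResidueCharIs : ℕ → Set (c ⊔ ℓ)
  ResidueCharIs p = ¬ IsUnit (fromℕ rR p)



IsAlgebraMap : ∀ {c₁ ℓ₁ c₂ ℓ₂} (O : CommutativeRing c₁ ℓ₁) (R : CommutativeRing c₂ ℓ₂) →
               (CommutativeRing.Carrier O → CommutativeRing.Carrier R) → Set (c₁ ⊔ ℓ₁ ⊔ ℓ₂)
IsAlgebraMap O R f =
  RingMorphisms.IsRingHomomorphism (CommutativeRing.rawRing O) (CommutativeRing.rawRing R) f

module Submission where

-- (1) Cayley–Hamilton, in the form needed: over the power series R[[x]] the
--     Laplace determinant of Defs satisfies (xI - A)·adj(xI - A) = χ·I;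
--     comparing coefficients and telescoping turns χ = x^m into A^m = 0.
-- (2) In any R-algebra, evaluating power series at an X with X^m = 0 is
--     multiplicative.  Hence exp(-X) is inverse to exp X, exp commutes with
--     conjugation and transposition, and exp is injective on such X
--     (compare (exp X - 1)^k = X^k + X^{k+1}·(…) for k = m, …, 1).
-- (3) With C = J⁻¹AᵀJ, skewness says C = -A, and orthogonality says
--     exp C = J⁻¹BᵀJ = B⁻¹ = exp(-A); injectivity of exp closes the loop.
-- The DVR, the prime p ≥ m and the symmetry of J only serve to make the
-- factorials k!, k < m, invertible, which IsExpOf already provides.

open import Defs
open import Algebra.Bundles using (Ring; CommutativeRing; RawRing)
open import Algebra.Structures using (IsRing)
import Algebra.Properties.Ring as RingProperties
import Algebra.Properties.CommutativeSemigroup as CommSemigroupProperties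
open import Data.Bool using (true; false; if_then_else_)
open import Data.Empty using (⊥-elim)
open import Data.Fin as Fin using (Fin; zero; suc; toℕ; punchIn; punchOut; inject₁; fromℕ<)
  renaming (fromℕ to lastFin)
open import Data.Fin.Properties
  using (punchInᵢ≢i; punchIn-punchOut; <-cmp; <⇒≢; fromℕ<-cong; toℕ-fromℕ<; fromℕ<-toℕ; toℕ<n;
         toℕ-inject₁; toℕ-fromℕ)
  renaming (_≟_ to _≟F_)
open import Data.Nat as ℕ using (ℕ; zero; suc; _∸_; _≤_; _<_; _≥_; z≤n; s≤s; _≤?_; _!)
import Data.Nat.Properties as ℕ
open import Data.Nat.Primality using (Prime)
open import Data.Product using (_×_; _,_; proj₁; proj₂)
open import Data.Sum using (_⊎_; inj₁; inj₂)
open import Function using (_∘_; _∘′_)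
open import Function.Bundles using (_⇔_; mk⇔)
open import Level using (_⊔_)
open import Relation.Nullary using (yes; no; ¬_; Dec)
open import Relation.Nullary.Decidable using (⌊_⌋)
open import Relation.Binary.Core using (Rel)
open import Relation.Binary.Definitions using (tri<; tri≈; tri>)
open import Relation.Binary.PropositionalEquality as ≡ using (_≡_; _≢_)
open import Relation.Binary.Structures using (IsEquivalence)

module RingLemmas {c ℓ} (R : Ring c ℓ) where
  open Ring R
  open RingProperties R public
    using (-‿involutive; -0#≈0#; -‿+-comm; +-inverseˡ-unique; -‿distribˡ-*; -‿distribʳ-*;
           x+x≈x⇒x≈0; +-cancelʳ)
  open CommSemigroupProperties +-commutativeSemigroup public
    using () renaming (x∙yz≈y∙xz to +-exchange; interchange to +-interchange)
  open import Relation.Binary.Reasoning.Setoid setoid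

  +-vanishʳ : ∀ {x y} → y ≈ 0# → x + y ≈ x
  +-vanishʳ {x} h = trans (+-congˡ h) (+-identityʳ x)

  +-vanishˡ : ∀ {x y} → x ≈ 0# → x + y ≈ y
  +-vanishˡ {y = y} h = trans (+-congʳ h) (+-identityˡ y)

  *-vanishʳ : ∀ {x y} → y ≈ 0# → x * y ≈ 0#
  *-vanishʳ {x} h = trans (*-congˡ h) (zeroʳ x)

  *-vanishˡ : ∀ {x y} → x ≈ 0# → x * y ≈ 0#
  *-vanishˡ {y = y} h = trans (*-congʳ h) (zeroˡ y)

  -x*-y≈x*y : ∀ x y → - x * - y ≈ x * y
  -x*-y≈x*y x y = begin
    - x * - y     ≈⟨ -‿distribˡ-* x (- y) ⟨
    - (x * - y)   ≈⟨ -‿cong (-‿distribʳ-* x y) ⟨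
    - (- (x * y)) ≈⟨ -‿involutive (x * y) ⟩
    x * y         ∎

module Powers {c ℓ} (R : Ring c ℓ) where
  open Ring R
  open import Algebra.Properties.Semiring.Exp semiring public using (_^_; ^-congˡ; ^-homo-*)

  ^-commute : ∀ x k → x ^ k * x ≈ x * x ^ k
  ^-commute x zero    = trans (*-identityˡ x) (sym (*-identityʳ x))
  ^-commute x (suc k) = trans (*-assoc x _ x) (*-congˡ (^-commute x k))

module CommutativeRingLemmas {c ℓ} (R : CommutativeRing c ℓ) where
  open CommutativeRing R
  open RingLemmas ring public
  open CommSemigroupProperties *-commutativeSemigroup public
    using () renaming (x∙yz≈y∙xz to *-exchange; interchange to *-interchange)

-- A ring structure from its laws, stated with a left identity/inverse
-- and both distributivities (the form in which they are easiest to prove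
-- for matrices and power series).
module MkRing {c ℓ} {A : Set c} (_≈_ : Rel A ℓ) (_+_ _*_ : A → A → A) (-_ : A → A) (0# 1# : A)
  (isEquivalence : IsEquivalence _≈_)
  (+-cong : ∀ {x y u v} → x ≈ y → u ≈ v → (x + u) ≈ (y + v))
  (+-assoc : ∀ x y z → ((x + y) + z) ≈ (x + (y + z)))
  (+-comm : ∀ x y → (x + y) ≈ (y + x))
  (+-identityˡ : ∀ x → (0# + x) ≈ x)
  (-‿inverseˡ : ∀ x → ((- x) + x) ≈ 0#)
  (-‿cong : ∀ {x y} → x ≈ y → (- x) ≈ (- y))
  (*-cong : ∀ {x y u v} → x ≈ y → u ≈ v → (x * u) ≈ (y * v))
  (*-assoc : ∀ x y z → ((x * y) * z) ≈ (x * (y * z)))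
  (*-identityˡ : ∀ x → (1# * x) ≈ x)
  (*-identityʳ : ∀ x → (x * 1#) ≈ x)
  (distribˡ : ∀ x y z → (x * (y + z)) ≈ ((x * y) + (x * z)))
  (distribʳ : ∀ x y z → ((y + z) * x) ≈ ((y * x) + (z * x)))
  where
  open IsEquivalence isEquivalence

  isRing : IsRing _≈_ _+_ _*_ -_ 0# 1#
  isRing = record
    { +-isAbelianGroup = record
      { isGroup = record
        { isMonoid = record
          { isSemigroup = record
            { isMagma = record { isEquivalence = isEquivalence ; ∙-cong = +-cong }
            ; assoc = +-assoc }
          ; identity = +-identityˡ , (λ x → trans (+-comm x 0#) (+-identityˡ x)) }
        ; inverse = -‿inverseˡ , (λ x → trans (+-comm x (- x)) (-‿inverseˡ x))
        ; ⁻¹-cong = -‿cong }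
      ; comm = +-comm }
    ; *-cong = *-cong
    ; *-assoc = *-assoc
    ; *-identity = *-identityˡ , *-identityʳ
    ; distrib = distribˡ , distribʳ
    }

  ring : Ring c ℓ
  ring = record { isRing = isRing }

  commutativeRing : (∀ x y → (x * y) ≈ (y * x)) → CommutativeRing c ℓ
  commutativeRing *-comm = record { isCommutativeRing = record { isRing = isRing ; *-comm = *-comm } }

module Sums {c ℓ} (S : Ring c ℓ) where
  open Ring S hiding (zero)
  open RingLemmas S
  open import Relation.Binary.Reasoning.Setoid setoid

  Σ : ∀ {n} → (Fin n → Carrier) → Carrier
  Σ = ∑ rawRing

  Σ-cong : ∀ {n} {f g : Fin n → Carrier} → (∀ i → f i ≈ g i) → Σ f ≈ Σ g
  Σ-cong {zero}  h = refl
  Σ-cong {suc n} h = +-cong (h zero) (Σ-cong (h ∘ suc))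

  Σ-vanish : ∀ {n} {f : Fin n → Carrier} → (∀ i → f i ≈ 0#) → Σ f ≈ 0#
  Σ-vanish {zero}  h = refl
  Σ-vanish {suc n} h = trans (+-vanishʳ (Σ-vanish (h ∘ suc))) (h zero)

  Σ-+ : ∀ {n} (f g : Fin n → Carrier) → Σ (λ i → f i + g i) ≈ Σ f + Σ g
  Σ-+ {zero}  f g = sym (+-identityʳ 0#)
  Σ-+ {suc n} f g = trans (+-congˡ (Σ-+ (f ∘ suc) (g ∘ suc))) (+-interchange _ _ _ _)

  Σ-*ˡ : ∀ {n} x (f : Fin n → Carrier) → x * Σ f ≈ Σ (λ i → x * f i)
  Σ-*ˡ {zero}  x f = zeroʳ x
  Σ-*ˡ {suc n} x f = trans (distribˡ x _ _) (+-congˡ (Σ-*ˡ x (f ∘ suc)))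

  Σ-*ʳ : ∀ {n} x (f : Fin n → Carrier) → Σ f * x ≈ Σ (λ i → f i * x)
  Σ-*ʳ {zero}  x f = zeroˡ x
  Σ-*ʳ {suc n} x f = trans (distribʳ x _ _) (+-congˡ (Σ-*ʳ x (f ∘ suc)))

  Σ-neg : ∀ {n} (f : Fin n → Carrier) → - Σ f ≈ Σ (λ i → - f i)
  Σ-neg {zero}  f = -0#≈0#
  Σ-neg {suc n} f = trans (sym (-‿+-comm _ _)) (+-congˡ (Σ-neg (f ∘ suc)))

  Σ-comm : ∀ {m n} (f : Fin m → Fin n → Carrier) →
           Σ (λ i → Σ (λ j → f i j)) ≈ Σ (λ j → Σ (λ i → f i j))
  Σ-comm {zero} {n} f = sym (Σ-vanish {n} (λ _ → refl))
  Σ-comm {suc m} f = begin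
    Σ (f zero) + Σ (λ i → Σ (f (suc i)))           ≈⟨ +-congˡ (Σ-comm (f ∘ suc)) ⟩
    Σ (f zero) + Σ (λ j → Σ (λ i → f (suc i) j))   ≈⟨ Σ-+ (f zero) _ ⟨
    Σ (λ j → f zero j + Σ (λ i → f (suc i) j))     ∎

  Σ-remove : ∀ {n} (i : Fin (suc n)) (f : Fin (suc n) → Carrier) → Σ f ≈ f i + Σ (f ∘ punchIn i)
  Σ-remove zero          f = refl
  Σ-remove {suc n} (suc i) f = trans (+-congˡ (Σ-remove i (f ∘ suc))) (+-exchange _ _ _)

  Σ-last : ∀ {n} (f : Fin (suc n) → Carrier) → Σ f ≈ Σ (f ∘ inject₁) + f (lastFin n)
  Σ-last {zero}  f = trans (+-identityʳ _) (sym (+-identityˡ _))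
  Σ-last {suc n} f = trans (+-congˡ (Σ-last (f ∘ suc))) (sym (+-assoc _ _ _))

  Σ-single : ∀ {n} (i : Fin n) (f : Fin n → Carrier) → (∀ j → j ≢ i → f j ≈ 0#) → Σ f ≈ f i
  Σ-single {suc n} i f h =
    trans (Σ-remove i f) (+-vanishʳ (Σ-vanish (λ k → h (punchIn i k) (punchInᵢ≢i i k))))

  δ : ∀ {n} → Fin n → Fin n → Carrier → Carrier
  δ i j a = if ⌊ i ≟F j ⌋ then a else 0#

  δ-same : ∀ {n} (i : Fin n) a → δ i i a ≈ a
  δ-same i a with i ≟F i
  ... | yes _ = refl
  ... | no i≢i = ⊥-elim (i≢i ≡.refl)

  δ-diff : ∀ {n} (i j : Fin n) a → i ≢ j → δ i j a ≈ 0#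
  δ-diff i j a i≢j with i ≟F j
  ... | yes i≡j = ⊥-elim (i≢j i≡j)
  ... | no _ = refl

  Σ-δ : ∀ {n} (i : Fin n) (f : Fin n → Carrier) → Σ (λ j → δ i j (f j)) ≈ f i
  Σ-δ i f = trans (Σ-single i _ (λ j j≢i → δ-diff i j (f j) (j≢i ∘ ≡.sym))) (δ-same i (f i))

  Σ-δˡ : ∀ {n} (i : Fin n) (f : Fin n → Carrier) → Σ (λ k → δ i k 1# * f k) ≈ f i
  Σ-δˡ i f = trans (Σ-single i _ (λ j j≢i → *-vanishˡ (δ-diff i j 1# (j≢i ∘ ≡.sym))))
                   (trans (*-congʳ (δ-same i 1#)) (*-identityˡ _))

  Σ-δʳ : ∀ {n} (j : Fin n) (f : Fin n → Carrier) → Σ (λ k → f k * δ k j 1#) ≈ f j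
  Σ-δʳ j f = trans (Σ-single j _ (λ k k≢j → *-vanishʳ (δ-diff k j 1# k≢j)))
                   (trans (*-congˡ (δ-same j 1#)) (*-identityʳ _))

module PowerSeries {c ℓ} (R : CommutativeRing c ℓ) where
  open CommutativeRing R hiding (zero)
  open CommutativeRingLemmas R
  open Sums ring
  open Over R using (PowSeries)
  open import Relation.Binary.Reasoning.Setoid setoid

  Series : Set c
  Series = ℕ → Carrier

  infixl 7 _⊛_
  infixl 6 _⊕_
  infix 4 _≋_

  _⊛_ : Series → Series → Series
  _⊛_ = RawRing._*_ PowSeries

  _⊕_ : Series → Series → Series
  (f ⊕ g) n = f n + g n

  _≋_ : Series → Series → Set ℓ
  f ≋ g = ∀ n → f n ≈ g n

  1S : Series
  1S = RawRing.1# PowSeries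

  scale : Carrier → Series → Series
  scale a f n = a * f n

  shift : Series → Series
  shift f n = f (suc n)

  xTimes : Series → Series
  xTimes f zero    = 0#
  xTimes f (suc n) = f n

  ⊛-cong : ∀ {f f' g g'} → f ≋ f' → g ≋ g' → f ⊛ g ≋ f' ⊛ g'
  ⊛-cong {f} {f'} {g} {g'} hf hg n =
    Σ-cong {suc n} {λ i → f (toℕ i) * g (n ∸ toℕ i)} {λ i → f' (toℕ i) * g' (n ∸ toℕ i)}
      (λ i → *-cong (hf (toℕ i)) (hg (n ∸ toℕ i)))

  ⊛-const : ∀ f g → (f ⊛ g) 0 ≈ f 0 * g 0
  ⊛-const f g = +-identityʳ _

  ⊛-distribʳ : ∀ f g h → (f ⊕ g) ⊛ h ≋ f ⊛ h ⊕ g ⊛ h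
  ⊛-distribʳ f g h n = trans (Σ-cong {suc n} {λ i → (f ⊕ g) (toℕ i) * h (n ∸ toℕ i)} (λ i → distribʳ (h (n ∸ toℕ i)) _ _))
    (Σ-+ {suc n} (λ i → f (toℕ i) * h (n ∸ toℕ i)) (λ i → g (toℕ i) * h (n ∸ toℕ i)))

  ⊛-distribˡ : ∀ f g h → h ⊛ (f ⊕ g) ≋ h ⊛ f ⊕ h ⊛ g
  ⊛-distribˡ f g h n = trans (Σ-cong {suc n} {λ i → h (toℕ i) * (f ⊕ g) (n ∸ toℕ i)} (λ i → distribˡ (h (toℕ i)) _ _))
    (Σ-+ {suc n} (λ i → h (toℕ i) * f (n ∸ toℕ i)) (λ i → h (toℕ i) * g (n ∸ toℕ i)))

  ⊛-scale : ∀ a f g → scale a f ⊛ g ≋ scale a (f ⊛ g)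
  ⊛-scale a f g n = trans (Σ-cong {suc n} {λ i → (a * f (toℕ i)) * g (n ∸ toℕ i)} (λ i → *-assoc a (f (toℕ i)) (g (n ∸ toℕ i))))
    (sym (Σ-*ˡ {suc n} a (λ i → f (toℕ i) * g (n ∸ toℕ i))))

  xTimes-⊛ : ∀ f g n → (xTimes f ⊛ g) (suc n) ≈ (f ⊛ g) n
  xTimes-⊛ f g n = +-vanishˡ (zeroˡ _)

  xTimes-⊛-const : ∀ f g → (xTimes f ⊛ g) 0 ≈ 0#
  xTimes-⊛-const f g = trans (⊛-const (xTimes f) g) (zeroˡ _)

  ⊛-split : ∀ f g → f ⊛ g ≋ scale (f 0) g ⊕ xTimes (shift f ⊛ g)
  ⊛-split f g zero    = trans (⊛-const f g) (sym (+-identityʳ _))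
  ⊛-split f g (suc n) = refl

  ⊛-assoc : ∀ n f g h → ((f ⊛ g) ⊛ h) n ≈ (f ⊛ (g ⊛ h)) n
  ⊛-assoc n f g h = begin
    ((f ⊛ g) ⊛ h) n                                   ≈⟨ ⊛-cong {f ⊛ g} {scale (f 0) g ⊕ xTimes (shift f ⊛ g)} {h} {h} (⊛-split f g) (λ _ → refl) n ⟩
    ((scale (f 0) g ⊕ xTimes (shift f ⊛ g)) ⊛ h) n    ≈⟨ ⊛-distribʳ (scale (f 0) g) (xTimes (shift f ⊛ g)) h n ⟩
    (scale (f 0) g ⊛ h) n + (xTimes (shift f ⊛ g) ⊛ h) n ≈⟨ +-congʳ (⊛-scale (f 0) g h n) ⟩
    f 0 * (g ⊛ h) n + (xTimes (shift f ⊛ g) ⊛ h) n     ≈⟨ tail n ⟩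
    (f ⊛ (g ⊛ h)) n                                   ∎
    where
    tail : ∀ n → f 0 * (g ⊛ h) n + (xTimes (shift f ⊛ g) ⊛ h) n ≈ (f ⊛ (g ⊛ h)) n
    tail zero    = trans (+-vanishʳ (xTimes-⊛-const (shift f ⊛ g) h)) (sym (⊛-const f (g ⊛ h)))
    tail (suc k) = +-congˡ (trans (xTimes-⊛ (shift f ⊛ g) h k) (⊛-assoc k (shift f) g h))

  -- Commutativity of the n-th coefficient, proved together with the
  -- (n+1)-th, since the step from n+2 uses both.
  CommutesAt : ℕ → Set _
  CommutesAt n = ∀ f g → (f ⊛ g) n ≈ (g ⊛ f) n

  commutesAt : ∀ n → CommutesAt n × CommutesAt (suc n)
  commutesAt zero = (λ f g → +-congʳ (*-comm _ _)) , (λ f g → begin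
    f 0 * g 1 + (f 1 * g 0 + 0#) ≈⟨ +-cong (*-comm _ _) (+-congʳ (*-comm _ _)) ⟩
    g 1 * f 0 + (g 0 * f 1 + 0#) ≈⟨ +-exchange _ _ _ ⟩
    g 0 * f 1 + (g 1 * f 0 + 0#) ∎)
  commutesAt (suc k) = proj₂ (commutesAt k) , step
    where
    atK = proj₁ (commutesAt k)
    atK+1 = proj₂ (commutesAt k)
    step : CommutesAt (suc (suc k))
    step f g = begin
      f 0 * g (2+k) + (shift f ⊛ g) (suc k)                          ≈⟨ +-congˡ (atK+1 (shift f) g) ⟩
      f 0 * g (2+k) + (g 0 * f (2+k) + (shift g ⊛ shift f) k)        ≈⟨ +-congˡ (+-congˡ (atK (shift g) (shift f))) ⟩
      f 0 * g (2+k) + (g 0 * f (2+k) + (shift f ⊛ shift g) k)        ≈⟨ +-exchange _ _ _ ⟩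
      g 0 * f (2+k) + (f 0 * g (2+k) + (shift f ⊛ shift g) k)        ≈⟨ +-congˡ (atK+1 (shift g) f) ⟨
      g 0 * f (2+k) + (shift g ⊛ f) (suc k)                          ∎
      where 2+k = suc (suc k)

  ⊛-comm : ∀ f g → f ⊛ g ≋ g ⊛ f
  ⊛-comm f g n = proj₁ (commutesAt n) f g

  ⊛-identityˡ : ∀ f → 1S ⊛ f ≋ f
  ⊛-identityˡ f zero    = trans (+-congʳ (*-identityˡ _)) (+-identityʳ _)
  ⊛-identityˡ f (suc n) = trans (+-cong (*-identityˡ _) (Σ-vanish {suc n} {λ i → 1S (suc (toℕ i)) * f (n ∸ toℕ i)} (λ i → zeroˡ _))) (+-identityʳ _)

  -- R[[x]]; its raw ring is PowSeries itself, so det over seriesRing is the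
  -- determinant used by Defs.charPoly
  seriesRing : CommutativeRing c ℓ
  seriesRing = MkRing.commutativeRing _≋_ _⊕_ _⊛_ (RawRing.-_ PowSeries) (RawRing.0# PowSeries) 1S
    (record { refl = λ _ → refl ; sym = λ h n → sym (h n) ; trans = λ h k n → trans (h n) (k n) })
    (λ h k n → +-cong (h n) (k n))
    (λ f g h n → +-assoc _ _ _)
    (λ f g n → +-comm _ _)
    (λ f n → +-identityˡ _)
    (λ f n → -‿inverseˡ _)
    (λ h n → -‿cong (h n))
    ⊛-cong
    (λ f g h n → ⊛-assoc n f g h)
    ⊛-identityˡ
    (λ f n → trans (⊛-comm f 1S n) (⊛-identityˡ f n))
    (λ f g h → ⊛-distribˡ g h f)
    (λ f g h n → trans (⊛-comm (g ⊕ h) f n) (trans (⊛-distribˡ g h f n) (+-cong (⊛-comm f g n) (⊛-comm f h n))))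
    ⊛-comm

-- Index bookkeeping for expanding a determinant along its first two rows.
-- squeeze j k is the position of column k among the columns ≠ j (a total
-- version of punchOut; its value at k = j is irrelevant).
module Squeeze where
  open ≡ using (refl; cong; module ≡-Reasoning)

  squeeze : ∀ {n} → Fin (suc (suc n)) → Fin (suc (suc n)) → Fin (suc n)
  squeeze zero    zero    = zero
  squeeze zero    (suc k) = k
  squeeze (suc j) zero    = zero
  squeeze {zero}  (suc j) (suc k) = zero
  squeeze {suc n} (suc j) (suc k) = suc (squeeze j k)

  squeeze-punchIn : ∀ {n} (j : Fin (suc (suc n))) (k : Fin (suc n)) → squeeze j (punchIn j k) ≡ k
  squeeze-punchIn zero    k       = refl
  squeeze-punchIn (suc j) zero    = refl
  squeeze-punchIn {suc n} (suc j) (suc k) = cong suc (squeeze-punchIn j k)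

  punchIn-squeeze-comm : ∀ {n} (j k : Fin (suc (suc n))) → j ≢ k → ∀ (l : Fin n) →
    punchIn j (punchIn (squeeze j k) l) ≡ punchIn k (punchIn (squeeze k j) l)
  punchIn-squeeze-comm zero    zero    j≢k l = ⊥-elim (j≢k refl)
  punchIn-squeeze-comm zero    (suc k) j≢k l = refl
  punchIn-squeeze-comm (suc j) zero    j≢k l = refl
  punchIn-squeeze-comm {suc n} (suc j) (suc k) j≢k zero    = refl
  punchIn-squeeze-comm {suc n} (suc j) (suc k) j≢k (suc l) =
    cong suc (punchIn-squeeze-comm j k (j≢k ∘′ cong suc) l)

  squeeze-< : ∀ {n} (j k : Fin (suc (suc n))) → j Fin.< k → suc (toℕ (squeeze j k)) ≡ toℕ k
  squeeze-< zero    (suc k) j<k = refl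
  squeeze-< {zero}  (suc zero) (suc zero) (s≤s ())
  squeeze-< {suc n} (suc j) (suc k) (s≤s j<k) = cong suc (squeeze-< j k j<k)

  squeeze-> : ∀ {n} (j k : Fin (suc (suc n))) → k Fin.< j → toℕ (squeeze j k) ≡ toℕ k
  squeeze-> (suc j) zero    k<j = refl
  squeeze-> {zero}  (suc zero) (suc zero) (s≤s ())
  squeeze-> {suc n} (suc j) (suc k) (s≤s k<j) = cong suc (squeeze-> j k k<j)

  -- the two orders of deleting columns j < k differ by one transposition
  squeeze-parity : ∀ {n} (j k : Fin (suc (suc n))) → j Fin.< k →
    suc (toℕ j ℕ.+ toℕ (squeeze j k)) ≡ toℕ k ℕ.+ toℕ (squeeze k j)
  squeeze-parity j k j<k = begin
    suc (toℕ j ℕ.+ toℕ (squeeze j k))  ≡⟨ ℕ.+-suc (toℕ j) _ ⟨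
    toℕ j ℕ.+ suc (toℕ (squeeze j k))  ≡⟨ cong (toℕ j ℕ.+_) (squeeze-< j k j<k) ⟩
    toℕ j ℕ.+ toℕ k                    ≡⟨ ℕ.+-comm (toℕ j) (toℕ k) ⟩
    toℕ k ℕ.+ toℕ j                    ≡⟨ cong (toℕ k ℕ.+_) (squeeze-> k j j<k) ⟨
    toℕ k ℕ.+ toℕ (squeeze k j)        ∎
    where open ≡-Reasoning

-- The Laplace-expansion determinant of Defs over a commutative ring is
-- alternating in the rows, hence satisfies M · adj(M) = det(M) · I.
module Determinants {c ℓ} (S : CommutativeRing c ℓ) where
  open CommutativeRing S hiding (zero)
  open CommutativeRingLemmas S
  open Sums ring
  open Squeeze
  open import Relation.Binary.Reasoning.Setoid setoid

  Matrix : ℕ → Set c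
  Matrix n = Fin n → Fin n → Carrier

  D : ∀ {n} → Matrix n → Carrier
  D = det rawRing

  sign : ℕ → Carrier
  sign = sgn rawRing

  sign-+ : ∀ a b → sign (a ℕ.+ b) ≈ sign a * sign b
  sign-+ zero    b = sym (*-identityˡ _)
  sign-+ (suc a) b = trans (-‿cong (sign-+ a b)) (-‿distribˡ-* _ _)

  sign-square : ∀ a → sign a * sign a ≈ 1#
  sign-square zero    = *-identityˡ _
  sign-square (suc a) = trans (-x*-y≈x*y _ _) (sign-square a)

  det-cong : ∀ {n} (M N : Matrix n) → (∀ i j → M i j ≈ N i j) → D M ≈ D N
  det-cong {zero}  M N h = refl
  det-cong {suc n} M N h = Σ-cong (λ j → *-cong (*-congˡ {sign (toℕ j)} (h zero j))
    (det-cong _ _ (λ i k → h (suc i) (punchIn j k))))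

  -- x if j < k, and 0 otherwise: selects one summand of each off-diagonal pair
  when< : ∀ {N} → Fin N → Fin N → Carrier → Carrier
  when< j k x = if ⌊ j Fin.<? k ⌋ then x else 0#

  when<-yes : ∀ {N} (j k : Fin N) x → j Fin.< k → when< j k x ≈ x
  when<-yes j k x j<k with j Fin.<? k
  ... | yes _ = refl
  ... | no j≮k = ⊥-elim (j≮k j<k)

  when<-no : ∀ {N} (j k : Fin N) x → ¬ (j Fin.< k) → when< j k x ≈ 0#
  when<-no j k x j≮k with j Fin.<? k
  ... | yes j<k = ⊥-elim (j≮k j<k)
  ... | no _ = refl

  when<-cong : ∀ {N} (j k : Fin N) {x y} → (j Fin.< k → x ≈ y) → when< j k x ≈ when< j k y
  when<-cong j k h with j Fin.<? k
  ... | yes j<k = h j<k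
  ... | no _ = refl

  when<-+ : ∀ {N} (j k : Fin N) x y → when< j k x + when< j k y ≈ when< j k (x + y)
  when<-+ j k x y with j Fin.<? k
  ... | yes _ = refl
  ... | no _ = +-identityʳ 0#

  when<-neg : ∀ {N} (j k : Fin N) x → when< j k (- x) ≈ - when< j k x
  when<-neg j k x with j Fin.<? k
  ... | yes _ = refl
  ... | no _ = sym -0#≈0#

  when<-pair : ∀ {N} (j k : Fin N) x → j ≢ k → when< j k x + when< k j x ≈ x
  when<-pair j k x j≢k with <-cmp j k
  ... | tri< j<k _ k≮j = trans (+-cong (when<-yes j k x j<k) (when<-no k j x k≮j)) (+-identityʳ x)
  ... | tri≈ _ j≡k _   = ⊥-elim (j≢k j≡k)
  ... | tri> j≮k _ k<j = trans (+-cong (when<-no j k x j≮k) (when<-yes k j x k<j)) (+-identityˡ x)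

  when<-refl : ∀ {N} (j : Fin N) x → when< j j x ≈ 0#
  when<-refl j x = when<-no j j x (ℕ.<-irrefl ≡.refl)

  when<-zero : ∀ {N} (j k : Fin N) → when< j k 0# ≈ 0#
  when<-zero j k with j Fin.<? k
  ... | yes _ = refl
  ... | no _  = refl

  Σ-offDiagonal : ∀ {n} (G : Matrix (suc n)) →
    Σ (λ j → Σ (λ k' → G j (punchIn j k'))) ≈ Σ (λ j → Σ (λ k → when< j k (G j k + G k j)))
  Σ-offDiagonal G = begin
    Σ (λ j → Σ (λ k' → G j (punchIn j k')))
      ≈⟨ Σ-cong (λ j → split j) ⟩
    Σ (λ j → Σ (λ k → when< j k (G j k) + when< k j (G j k)))
      ≈⟨ Σ-cong (λ j → Σ-+ (λ k → when< j k (G j k)) (λ k → when< k j (G j k))) ⟩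
    Σ (λ j → Σ (λ k → when< j k (G j k)) + Σ (λ k → when< k j (G j k)))
      ≈⟨ Σ-+ (λ j → Σ (λ k → when< j k (G j k))) (λ j → Σ (λ k → when< k j (G j k))) ⟩
    Σ (λ j → Σ (λ k → when< j k (G j k))) + Σ (λ j → Σ (λ k → when< k j (G j k)))
      ≈⟨ +-congˡ (Σ-comm (λ j k → when< k j (G j k))) ⟩
    Σ (λ j → Σ (λ k → when< j k (G j k))) + Σ (λ k → Σ (λ j → when< k j (G j k)))
      ≈⟨ Σ-+ (λ j → Σ (λ k → when< j k (G j k))) (λ j → Σ (λ k → when< j k (G k j))) ⟨
    Σ (λ j → Σ (λ k → when< j k (G j k)) + Σ (λ k → when< j k (G k j)))
      ≈⟨ Σ-cong (λ j → trans (sym (Σ-+ (λ k → when< j k (G j k)) (λ k → when< j k (G k j))))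
                              (Σ-cong (λ k → when<-+ j k (G j k) (G k j)))) ⟩
    Σ (λ j → Σ (λ k → when< j k (G j k + G k j))) ∎
    where
    -- the term k = j contributes 0; every other term is split by order
    split : ∀ j → Σ (λ k' → G j (punchIn j k')) ≈ Σ (λ k → when< j k (G j k) + when< k j (G j k))
    split j = sym (trans (Σ-remove j (λ k → when< j k (G j k) + when< k j (G j k)))
      (trans (+-vanishˡ (trans (+-cong (when<-refl j _) (when<-refl j _)) (+-identityʳ 0#)))
        (Σ-cong (λ k' → when<-pair j (punchIn j k') _ (punchInᵢ≢i j k' ∘ ≡.sym)))))

  -- The summand of det M expanded along its first two rows a, b (the rest
  -- being R): column j from row a, column k from row b, and the minor.
  expansionTerm : ∀ {n} (a b : Fin (suc (suc n)) → Carrier) (R : Fin n → Fin (suc (suc n)) → Carrier)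
    (j k : Fin (suc (suc n))) (k' : Fin (suc n)) → Carrier
  expansionTerm a b R j k k' =
    (sign (toℕ j) * a j) * ((sign (toℕ k') * b k) * D (λ i l → R i (punchIn j (punchIn k' l))))

  twoRowTerm : ∀ {n} (a b : Fin (suc (suc n)) → Carrier) (R : Fin n → Fin (suc (suc n)) → Carrier) →
    Matrix (suc (suc n))
  twoRowTerm a b R j k = expansionTerm a b R j k (squeeze j k)

  rows₂ : ∀ {n} → Matrix (suc (suc n)) → Fin n → Fin (suc (suc n)) → Carrier
  rows₂ M i = M (suc (suc i))

  det-expand₂ : ∀ {n} (M : Matrix (suc (suc n))) →
    D M ≈ Σ (λ j → Σ (λ k' → twoRowTerm (M zero) (M (suc zero)) (rows₂ M) j (punchIn j k')))
  det-expand₂ M = Σ-cong (λ j → trans (Σ-*ˡ (sign (toℕ j) * M zero j)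
      (λ k' → (sign (toℕ k') * M (suc zero) (punchIn j k')) * D (λ i l → M (suc (suc i)) (punchIn j (punchIn k' l)))))
    (Σ-cong (λ k' →
    reflexive (≡.cong (expansionTerm (M zero) (M (suc zero)) (rows₂ M) j (punchIn j k'))
                      (≡.sym (squeeze-punchIn j k'))))))

  sign-squeeze : ∀ {n} (j k : Fin (suc (suc n))) → j ≢ k →
    sign (toℕ j) * sign (toℕ (squeeze j k)) ≈ - (sign (toℕ k) * sign (toℕ (squeeze k j)))
  sign-squeeze j k j≢k with <-cmp j k
  ... | tri< j<k _ _ = begin
    sign (toℕ j) * sign (toℕ (squeeze j k))     ≈⟨ sign-+ (toℕ j) _ ⟨
    sign (toℕ j ℕ.+ toℕ (squeeze j k))          ≈⟨ -‿involutive _ ⟨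
    - sign (suc (toℕ j ℕ.+ toℕ (squeeze j k)))  ≡⟨ ≡.cong (λ t → - sign t) (squeeze-parity j k j<k) ⟩
    - sign (toℕ k ℕ.+ toℕ (squeeze k j))        ≈⟨ -‿cong (sign-+ (toℕ k) _) ⟩
    - (sign (toℕ k) * sign (toℕ (squeeze k j))) ∎
  ... | tri≈ _ j≡k _ = ⊥-elim (j≢k j≡k)
  ... | tri> _ _ k<j = begin
    sign (toℕ j) * sign (toℕ (squeeze j k))     ≈⟨ sign-+ (toℕ j) _ ⟨
    sign (toℕ j ℕ.+ toℕ (squeeze j k))          ≡⟨ ≡.cong sign (≡.sym (squeeze-parity k j k<j)) ⟩
    - sign (toℕ k ℕ.+ toℕ (squeeze k j))        ≈⟨ -‿cong (sign-+ (toℕ k) _) ⟩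
    - (sign (toℕ k) * sign (toℕ (squeeze k j))) ∎

  twoRowTerm-swap : ∀ {n} (a b : Fin (suc (suc n)) → Carrier) (R : Fin n → Fin (suc (suc n)) → Carrier)
    (j k : Fin (suc (suc n))) → j ≢ k → twoRowTerm b a R j k ≈ - twoRowTerm a b R k j
  twoRowTerm-swap a b R j k j≢k = begin
    twoRowTerm b a R j k                                                  ≈⟨ regroup _ _ _ _ _ ⟩
    ((sign (toℕ j) * sign (toℕ (squeeze j k))) * (b j * a k)) * Djk       ≈⟨ *-cong (*-cong (sign-squeeze j k j≢k) (*-comm _ _)) minors ⟩
    (- (sign (toℕ k) * sign (toℕ (squeeze k j))) * (a k * b j)) * Dkj     ≈⟨ *-congʳ (-‿distribˡ-* _ _) ⟨
    (- ((sign (toℕ k) * sign (toℕ (squeeze k j))) * (a k * b j))) * Dkj   ≈⟨ -‿distribˡ-* _ _ ⟨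
    - (((sign (toℕ k) * sign (toℕ (squeeze k j))) * (a k * b j)) * Dkj)   ≈⟨ -‿cong (regroup _ _ _ _ _) ⟨
    - twoRowTerm a b R k j                                                ∎
    where
    Djk = D (λ i l → R i (punchIn j (punchIn (squeeze j k) l)))
    Dkj = D (λ i l → R i (punchIn k (punchIn (squeeze k j) l)))
    minors : Djk ≈ Dkj
    minors = det-cong _ _ (λ i l → reflexive (≡.cong (R i) (punchIn-squeeze-comm j k j≢k l)))
    regroup : ∀ x y u v d → (x * y) * ((u * v) * d) ≈ ((x * u) * (y * v)) * d
    regroup x y u v d = trans (sym (*-assoc _ _ _)) (*-congʳ (*-interchange x y u v))

  det-equalRows₀₁ : ∀ {n} (M : Matrix (suc (suc n))) → (∀ l → M zero l ≈ M (suc zero) l) → D M ≈ 0#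
  det-equalRows₀₁ M row₀≈row₁ = begin
    D M                                                               ≈⟨ det-expand₂ M ⟩
    Σ (λ j → Σ (λ k' → twoRowTerm a b R j (punchIn j k')))            ≈⟨ Σ-cong (λ j → Σ-cong (λ k' → use-a j (punchIn j k'))) ⟩
    Σ (λ j → Σ (λ k' → twoRowTerm a a R j (punchIn j k')))            ≈⟨ Σ-offDiagonal (twoRowTerm a a R) ⟩
    Σ (λ j → Σ (λ k → when< j k (twoRowTerm a a R j k + twoRowTerm a a R k j)))
              ≈⟨ Σ-vanish (λ j → Σ-vanish (λ k → cancel j k)) ⟩
    0#                                                                ∎
    where
    a = M zero
    b = M (suc zero)
    R = rows₂ M
    use-a : ∀ j k → twoRowTerm a b R j k ≈ twoRowTerm a a R j k
    use-a j k = *-congˡ (*-congʳ (*-congˡ (sym (row₀≈row₁ k))))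
    cancel : ∀ j k → when< j k (twoRowTerm a a R j k + twoRowTerm a a R k j) ≈ 0#
    cancel j k = trans (when<-cong j k (λ j<k →
        trans (+-congˡ (twoRowTerm-swap a a R k j (<⇒≢ j<k ∘ ≡.sym))) (-‿inverseʳ _)))
      (when<-zero j k)

  swap₀₁ : ∀ {n} → Matrix (suc (suc n)) → Matrix (suc (suc n))
  swap₀₁ M zero          = M (suc zero)
  swap₀₁ M (suc zero)    = M zero
  swap₀₁ M (suc (suc i)) = M (suc (suc i))

  det-swap₀₁ : ∀ {n} (M : Matrix (suc (suc n))) → D (swap₀₁ M) ≈ - D M
  det-swap₀₁ M = begin
    D (swap₀₁ M)                                                  ≈⟨ det-expand₂ (swap₀₁ M) ⟩
    Σ (λ j → Σ (λ k' → twoRowTerm b a R j (punchIn j k')))        ≈⟨ Σ-offDiagonal (twoRowTerm b a R) ⟩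
    Σ (λ j → Σ (λ k → when< j k (twoRowTerm b a R j k + twoRowTerm b a R k j)))
          ≈⟨ Σ-cong (λ j → Σ-cong (λ k → negate j k)) ⟩
    Σ (λ j → Σ (λ k → - T j k))                                   ≈⟨ Σ-cong (λ j → Σ-neg (T j)) ⟨
    Σ (λ j → - Σ (T j))                                           ≈⟨ Σ-neg (λ j → Σ (T j)) ⟨
    - Σ (λ j → Σ (T j))                                           ≈⟨ -‿cong (Σ-offDiagonal (twoRowTerm a b R)) ⟨
    - Σ (λ j → Σ (λ k' → twoRowTerm a b R j (punchIn j k')))      ≈⟨ -‿cong (det-expand₂ M) ⟨
    - D M                                                         ∎
    where
    a = M zero
    b = M (suc zero)
    R = rows₂ M
    T : Matrix _
    T j k = when< j k (twoRowTerm a b R j k + twoRowTerm a b R k j)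
    negate : ∀ j k → when< j k (twoRowTerm b a R j k + twoRowTerm b a R k j) ≈ - T j k
    negate j k = trans (when<-cong j k (λ j<k →
        trans (+-cong (twoRowTerm-swap a b R j k (<⇒≢ j<k)) (twoRowTerm-swap a b R k j (<⇒≢ j<k ∘ ≡.sym)))
              (trans (-‿+-comm _ _) (-‿cong (+-comm _ _)))))
      (when<-neg j k _)

  rowToFront : ∀ {n} → Fin (suc n) → Matrix (suc n) → Matrix (suc n)
  rowToFront r M zero    = M r
  rowToFront r M (suc i) = M (punchIn r i)

  -- ... which amounts to r transpositions of adjacent rows
  det-rowToFront : ∀ {n} (r : Fin (suc n)) (M : Matrix (suc n)) → D (rowToFront r M) ≈ sign (toℕ r) * D M
  det-rowToFront zero M = trans (det-cong _ _ same) (sym (*-identityˡ _))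
    where
    same : ∀ i j → rowToFront zero M i j ≈ M i j
    same zero    j = refl
    same (suc i) j = refl
  det-rowToFront {suc n} (suc r) M = begin
    D N                                                        ≈⟨ -‿involutive _ ⟨
    - (- D N)                                                  ≈⟨ -‿cong (det-swap₀₁ N) ⟨
    - D (swap₀₁ N)                                             ≈⟨ -‿cong (Σ-cong (λ j → *-congˡ {a j} (det-cong _ _ (minor j)))) ⟩
    - Σ (λ j → a j * D (rowToFront r (M₀ j)))                 ≈⟨ -‿cong (Σ-cong (λ j → *-congˡ {a j} (det-rowToFront r (M₀ j)))) ⟩
    - Σ (λ j → a j * (sign (toℕ r) * D (M₀ j)))               ≈⟨ -‿cong (Σ-cong (λ j → *-exchange (a j) (sign (toℕ r)) (D (M₀ j)))) ⟩
    - Σ (λ j → sign (toℕ r) * (a j * D (M₀ j)))               ≈⟨ -‿cong (Σ-*ˡ (sign (toℕ r)) (λ j → a j * D (M₀ j))) ⟨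
    - (sign (toℕ r) * D M)                                     ≈⟨ -‿distribˡ-* _ _ ⟩
    (- sign (toℕ r)) * D M                                     ∎
    where
    N = rowToFront (suc r) M
    a : Fin (suc (suc n)) → Carrier
    a j = sign (toℕ j) * M zero j
    M₀ : Fin (suc (suc n)) → Matrix (suc n)
    M₀ j i k = M (suc i) (punchIn j k)
    minor : ∀ j i k → swap₀₁ N (suc i) (punchIn j k) ≈ rowToFront r (M₀ j) i k
    minor j zero    k = refl
    minor j (suc i) k = refl

  det-repeatedRow : ∀ {n} (t : Fin n) (M : Matrix (suc n)) → (∀ l → M zero l ≈ M (suc t) l) → D M ≈ 0#
  det-repeatedRow {suc n} t M row₀≈rowₜ = begin
    D M                                          ≈⟨ *-identityˡ _ ⟨
    1# * D M                                     ≈⟨ *-congʳ (sign-square (toℕ (suc t))) ⟨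
    (s * s) * D M                                ≈⟨ *-assoc _ _ _ ⟩
    s * (s * D M)                                ≈⟨ *-congˡ (det-rowToFront (suc t) M) ⟨
    s * D (rowToFront (suc t) M)                 ≈⟨ *-vanishʳ (det-equalRows₀₁ (rowToFront (suc t) M) (sym ∘ row₀≈rowₜ)) ⟩
    0#                                           ∎
    where s = sign (toℕ (suc t))

  adj : ∀ {n} → Matrix (suc n) → Matrix (suc n)
  adj M j r = sign (toℕ r) * (sign (toℕ j) * D (λ i k → M (punchIn r i) (punchIn j k)))

  replaceRow : ∀ {n} → Matrix (suc n) → Fin (suc n) → Fin (suc n) → Matrix (suc n)
  replaceRow M a r zero    = M a
  replaceRow M a r (suc i) = M (punchIn r i)

  det-replaceRow : ∀ {n} (M : Matrix (suc n)) (a r : Fin (suc n)) → a ≢ r → D (replaceRow M a r) ≈ 0#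
  det-replaceRow {zero}  M zero zero a≢r = ⊥-elim (a≢r ≡.refl)
  det-replaceRow {suc n} M a r a≢r = det-repeatedRow (punchOut r≢a) (replaceRow M a r)
    (λ l → reflexive (≡.cong (λ z → M z l) (≡.sym (punchIn-punchOut r≢a))))
    where r≢a = a≢r ∘ ≡.sym

  det-adjugate : ∀ {n} (M : Matrix (suc n)) (a r : Fin (suc n)) →
    Σ (λ j → M a j * adj M j r) ≈ δ a r (D M)
  det-adjugate M a r = trans expandRow (cases (a ≟F r))
    where
    K = replaceRow M a r
    Mʳ : Fin (suc _) → Carrier
    Mʳ j = D (λ i k → M (punchIn r i) (punchIn j k))
    expandRow : Σ (λ j → M a j * adj M j r) ≈ sign (toℕ r) * D K
    expandRow = begin
      Σ (λ j → M a j * adj M j r)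
        ≈⟨ Σ-cong (λ j → shuffle (M a j) (sign (toℕ r)) (sign (toℕ j)) (Mʳ j)) ⟩
      Σ (λ j → sign (toℕ r) * ((sign (toℕ j) * M a j) * Mʳ j))
        ≈⟨ Σ-*ˡ (sign (toℕ r)) (λ j → (sign (toℕ j) * M a j) * Mʳ j) ⟨
      sign (toℕ r) * D K ∎
      where
      shuffle : ∀ m x y d → m * (x * (y * d)) ≈ x * ((y * m) * d)
      shuffle m x y d = trans (*-exchange m x _) (*-congˡ (trans (*-exchange m y d) (sym (*-assoc y m d))))
    cases : Dec (a ≡ r) → sign (toℕ r) * D K ≈ δ a r (D M)
    cases (yes ≡.refl) = begin
      sign (toℕ r) * D K                       ≈⟨ *-congˡ (det-cong K (rowToFront r M) same) ⟩
      sign (toℕ r) * D (rowToFront r M)        ≈⟨ *-congˡ (det-rowToFront r M) ⟩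
      sign (toℕ r) * (sign (toℕ r) * D M)      ≈⟨ *-assoc _ _ _ ⟨
      (sign (toℕ r) * sign (toℕ r)) * D M      ≈⟨ *-congʳ (sign-square (toℕ r)) ⟩
      1# * D M                                 ≈⟨ *-identityˡ _ ⟩
      D M                                      ≈⟨ δ-same r (D M) ⟨
      δ r r (D M)                              ∎
      where
      same : ∀ i j → K i j ≈ rowToFront r M i j
      same zero    j = refl
      same (suc i) j = refl
    cases (no a≢r) = trans (*-vanishʳ (det-replaceRow M a r a≢r)) (sym (δ-diff a r (D M) a≢r))

record AlgebraOver {c ℓ c' ℓ'} (R : CommutativeRing c ℓ) (𝕄 : Ring c' ℓ') : Set (c ⊔ ℓ ⊔ c' ⊔ ℓ') where
  private
    module R = CommutativeRing R
    module 𝕄 = Ring 𝕄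
  infixr 7 _·_
  field
    _·_         : R.Carrier → 𝕄.Carrier → 𝕄.Carrier
    ·-cong      : ∀ {r r' x y} → r R.≈ r' → x 𝕄.≈ y → (r · x) 𝕄.≈ (r' · y)
    ·-*ˡ        : ∀ r x y → ((r · x) 𝕄.* y) 𝕄.≈ (r · (x 𝕄.* y))
    ·-*ʳ        : ∀ r x y → (x 𝕄.* (r · y)) 𝕄.≈ (r · (x 𝕄.* y))
    ·-distribʳ  : ∀ r s x → ((r R.+ s) · x) 𝕄.≈ ((r · x) 𝕄.+ (s · x))
    ·-distribˡ  : ∀ r x y → (r · (x 𝕄.+ y)) 𝕄.≈ ((r · x) 𝕄.+ (r · y))
    ·-assoc     : ∀ r s x → ((r R.* s) · x) 𝕄.≈ (r · (s · x))
    ·-identity  : ∀ x → (R.1# · x) 𝕄.≈ x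

module Matrices {c ℓ} (R : CommutativeRing c ℓ) where
  open CommutativeRing R hiding (zero)
  open CommutativeRingLemmas R
  open Sums ring
  open Over R hiding (_^_)
  open import Relation.Binary.Reasoning.Setoid setoid

  -M_ : ∀ {m} → Mat m → Mat m
  (-M A) i j = - A i j

  module _ {m : ℕ} where
    *M-assoc : ∀ (A B C : Mat m) → ((A *M B) *M C) ≈M (A *M (B *M C))
    *M-assoc A B C i j = begin
      Σ (λ k → Σ (λ l → A i l * B l k) * C k j)   ≈⟨ Σ-cong (λ k → Σ-*ʳ (C k j) (λ l → A i l * B l k)) ⟩
      Σ (λ k → Σ (λ l → (A i l * B l k) * C k j)) ≈⟨ Σ-comm (λ k l → (A i l * B l k) * C k j) ⟩
      Σ (λ l → Σ (λ k → (A i l * B l k) * C k j)) ≈⟨ Σ-cong (λ l → Σ-cong (λ k → *-assoc (A i l) (B l k) (C k j))) ⟩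
      Σ (λ l → Σ (λ k → A i l * (B l k * C k j))) ≈⟨ Σ-cong (λ l → Σ-*ˡ (A i l) (λ k → B l k * C k j)) ⟨
      Σ (λ l → A i l * Σ (λ k → B l k * C k j))   ∎

    *M-cong : ∀ {A A' B B' : Mat m} → A ≈M A' → B ≈M B' → (A *M B) ≈M (A' *M B')
    *M-cong A≈A' B≈B' i j = Σ-cong (λ l → *-cong (A≈A' i l) (B≈B' l j))

    matrixRing : Ring c ℓ
    matrixRing = MkRing.ring (_≈M_ {m}) _+M_ _*M_ -M_ 0M 1M
      (record { refl = λ i j → refl ; sym = λ h i j → sym (h i j) ; trans = λ h k i j → trans (h i j) (k i j) })
      (λ h k i j → +-cong (h i j) (k i j))
      (λ A B C i j → +-assoc _ _ _)
      (λ A B i j → +-comm _ _)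
      (λ A i j → +-identityˡ _)
      (λ A i j → -‿inverseˡ _)
      (λ h i j → -‿cong (h i j))
      *M-cong *M-assoc
      (λ A i j → Σ-δˡ i (λ k → A k j))
      (λ A i j → Σ-δʳ j (λ k → A i k))
      (λ A B C i j → trans (Σ-cong (λ k → distribˡ (A i k) _ _)) (Σ-+ (λ k → A i k * B k j) (λ k → A i k * C k j)))
      (λ A B C i j → trans (Σ-cong (λ k → distribʳ (A k j) _ _)) (Σ-+ (λ k → B i k * A k j) (λ k → C i k * A k j)))

    matrixAlgebra : AlgebraOver R matrixRing
    matrixAlgebra = record
      { _·_        = _·M_
      ; ·-cong     = λ r≈r' A≈B i j → *-cong r≈r' (A≈B i j)
      ; ·-*ˡ       = λ r A B i j → trans (Σ-cong (λ k → *-assoc r (A i k) (B k j))) (sym (Σ-*ˡ r (λ k → A i k * B k j)))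
      ; ·-*ʳ       = λ r A B i j → trans (Σ-cong (λ k → *-exchange (A i k) r (B k j))) (sym (Σ-*ˡ r (λ k → A i k * B k j)))
      ; ·-distribʳ = λ r s A i j → distribʳ _ _ _
      ; ·-distribˡ = λ r A B i j → distribˡ _ _ _
      ; ·-assoc    = λ r s A i j → *-assoc _ _ _
      ; ·-identity = λ A i j → *-identityˡ _
      }

    open Powers matrixRing using (_^_)

    ^M≡^ : ∀ (A : Mat m) k → (A ^M k) ≡ (A ^ k)
    ^M≡^ A zero    = ≡.refl
    ^M≡^ A (suc k) = ≡.cong (A *M_) (^M≡^ A k)

    Σ-entry : ∀ {n} (F : Fin n → Mat m) i j → Sums.Σ matrixRing F i j ≈ Σ (λ k → F k i j)
    Σ-entry {zero}  F i j = refl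
    Σ-entry {suc n} F i j = +-congˡ (Σ-entry (λ k → F (suc k)) i j)

    ᵀ-*M : ∀ (A B : Mat m) → ((A *M B) ᵀ) ≈M ((B ᵀ) *M (A ᵀ))
    ᵀ-*M A B i j = Σ-cong (λ k → *-comm (A j k) (B k i))

    ᵀ-1M : ((1M {m}) ᵀ) ≈M 1M
    ᵀ-1M i j with i ≟F j | j ≟F i
    ... | yes _   | yes _   = refl
    ... | no _    | no _    = refl
    ... | yes i≡j | no j≢i  = ⊥-elim (j≢i (≡.sym i≡j))
    ... | no i≢j  | yes j≡i = ⊥-elim (i≢j (≡.sym j≡i))

-- In any ring: if  B₋₁ = 0  and  Bₙ₋₁ - A·Bₙ = Cₙ  with every Cₙ commuting
-- with the powers of A, then  Σ_{n ≤ N} Cₙ·Aⁿ = -A^{N+1}·B_N.  (Bₓ n plays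
-- the role of Bₙ₋₁.)  This is the telescoping step of Cayley–Hamilton.
module Telescoping {c ℓ} (𝕄 : Ring c ℓ) where
  open Ring 𝕄
  open RingLemmas 𝕄
  open Powers 𝕄
  open import Relation.Binary.Reasoning.Setoid setoid

  module Telescope (A : Carrier) (B Bₓ C : ℕ → Carrier)
           (recurrence : ∀ n → Bₓ n - A * B n ≈ C n)
           (Bₓ-zero : Bₓ 0 ≈ 0#) (Bₓ-suc : ∀ n → Bₓ (suc n) ≈ B n)
           (central : ∀ n k → C n * A ^ k ≈ A ^ k * C n) where

    partialSum : ℕ → Carrier
    partialSum zero    = C 0
    partialSum (suc N) = partialSum N + C (suc N) * A ^ suc N

    telescope : ∀ N → partialSum N ≈ - (A ^ suc N * B N)
    telescope zero = begin
      C 0                        ≈⟨ recurrence 0 ⟨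
      Bₓ 0 - A * B 0             ≈⟨ +-vanishˡ Bₓ-zero ⟩
      - (A * B 0)                ≈⟨ -‿cong (*-congʳ (*-identityʳ A)) ⟨
      - ((A * 1#) * B 0)         ∎
    telescope (suc N) = begin
      partialSum N + C (suc N) * P                    ≈⟨ +-cong (telescope N) (central (suc N) (suc N)) ⟩
      - (P * B N) + P * C (suc N)                     ≈⟨ +-congˡ (*-congˡ (recurrence (suc N))) ⟨
      - (P * B N) + P * (Bₓ (suc N) - A * B (suc N))  ≈⟨ +-congˡ (*-congˡ (+-congʳ (Bₓ-suc N))) ⟩
      - (P * B N) + P * (B N - A * B (suc N))         ≈⟨ +-congˡ (distribˡ _ _ _) ⟩
      - (P * B N) + (P * B N + P * - (A * B (suc N))) ≈⟨ +-assoc _ _ _ ⟨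
      (- (P * B N) + P * B N) + P * - (A * B (suc N)) ≈⟨ +-vanishˡ (-‿inverseˡ _) ⟩
      P * - (A * B (suc N))                           ≈⟨ -‿distribʳ-* _ _ ⟨
      - (P * (A * B (suc N)))                         ≈⟨ -‿cong (*-assoc _ _ _) ⟨
      - ((P * A) * B (suc N))                         ≈⟨ -‿cong (*-congʳ (^-commute A (suc N))) ⟩
      - ((A * P) * B (suc N))                         ∎
      where P = A ^ suc N

module CayleyHamilton {c ℓ} (R : CommutativeRing c ℓ) where
  open CommutativeRing R hiding (zero)
  open CommutativeRingLemmas R
  open Sums ring
  open PowerSeries R
  open Matrices R
  open Over R hiding (_^_)
  module SeriesSum = Sums (CommutativeRing.ring seriesRing)
  module SeriesDet = Determinants seriesRing

  if-≟-yes : ∀ {a} {A : Set a} n {x y : A} → (if ⌊ n ℕ.≟ n ⌋ then x else y) ≡ x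
  if-≟-yes n with n ℕ.≟ n
  ... | yes _   = ≡.refl
  ... | no n≢n = ⊥-elim (n≢n ≡.refl)

  if-≟-no : ∀ {a} {A : Set a} {n k} {x y : A} → n ≢ k → (if ⌊ n ℕ.≟ k ⌋ then x else y) ≡ y
  if-≟-no {n = n} {k} n≢k with n ℕ.≟ k
  ... | yes n≡k = ⊥-elim (n≢k n≡k)
  ... | no _    = ≡.refl

  DegreeAtMost : ℕ → Series → Set _
  DegreeAtMost d f = ∀ n → d < n → f n ≈ 0#

  private
    ∸-mono-< : ∀ i a b n → i ≤ a → a ℕ.+ b < n → b < n ∸ i
    ∸-mono-< zero    a       b n       _         a+b<n       = ℕ.≤-<-trans (ℕ.m≤n+m b a) a+b<n
    ∸-mono-< (suc i) (suc a) b (suc n) (s≤s i≤a) (s≤s a+b<n) = ∸-mono-< i a b n i≤a a+b<n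

  degree-⊛ : ∀ a b f g → DegreeAtMost a f → DegreeAtMost b g → DegreeAtMost (a ℕ.+ b) (f ⊛ g)
  degree-⊛ a b f g degf degg n a+b<n = Σ-vanish {suc n} (λ i → vanish i)
    where
    vanish : ∀ i → f (toℕ i) * g (n ∸ toℕ i) ≈ 0#
    vanish i with toℕ i ≤? a
    ... | yes i≤a = *-vanishʳ (degg _ (∸-mono-< (toℕ i) a b n i≤a a+b<n))
    ... | no  i≰a = *-vanishˡ (degf _ (ℕ.≰⇒> i≰a))

  Σ-coeff : ∀ {k} (F : Fin k → Series) n → SeriesSum.Σ F n ≈ Σ (λ j → F j n)
  Σ-coeff {zero}  F n = refl
  Σ-coeff {suc k} F n = +-congˡ (Σ-coeff (F ∘ suc) n)

  degree-Σ : ∀ {k} d (F : Fin k → Series) → (∀ j → DegreeAtMost d (F j)) → DegreeAtMost d (SeriesSum.Σ F)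
  degree-Σ d F degF n d<n = trans (Σ-coeff F n) (Σ-vanish (λ j → degF j n d<n))

  degree-sign : ∀ t → DegreeAtMost 0 (SeriesDet.sign t)
  degree-sign zero    (suc n) _ = refl
  degree-sign (suc t) n 0<n = trans (-‿cong (degree-sign t n 0<n)) -0#≈0#

  degree-det : ∀ {k} (M : Fin k → Fin k → Series) → (∀ i j → DegreeAtMost 1 (M i j)) → DegreeAtMost k (SeriesDet.D M)
  degree-det {zero}  M degM (suc n) _ = refl
  degree-det {suc k} M degM = degree-Σ (suc k) _ (λ j →
    degree-⊛ 1 k _ _ (degree-⊛ 0 1 _ _ (degree-sign (toℕ j)) (degM zero j))
      (degree-det (λ i l → M (suc i) (punchIn j l)) (λ i l → degM (suc i) (punchIn j l))))

  charMatrix : ∀ {m} → Mat m → Fin m → Fin m → Series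
  charMatrix A i j n = (if ⌊ i ≟F j ⌋ then X n else 0#) - const (A i j) n

  charMatrix-degree : ∀ {m} (A : Mat m) i j → DegreeAtMost 1 (charMatrix A i j)
  charMatrix-degree A i j (suc zero)    (s≤s ())
  charMatrix-degree A i j (suc (suc n)) _ = trans (+-vanishˡ (diagonal ⌊ i ≟F j ⌋)) -0#≈0#
    where
    diagonal : ∀ b → (if b then X (suc (suc n)) else 0#) ≈ 0#
    diagonal true  = refl
    diagonal false = refl

  X-⊛ : ∀ g → X ⊛ g ≋ xTimes g
  X-⊛ g zero    = trans (⊛-const X g) (zeroˡ _)
  X-⊛ g (suc n) = trans (xTimes-⊛ 1S g n) (⊛-identityˡ g n)

  const-⊛ : ∀ a g n → (const a ⊛ g) n ≈ a * g n
  const-⊛ a g n = trans (⊛-cong {const a} {scale a 1S} {g} {g} const≋scale (λ _ → refl) n)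
    (trans (⊛-scale a 1S g n) (*-congˡ (⊛-identityˡ g n)))
    where
    const≋scale : const a ≋ scale a 1S
    const≋scale zero    = sym (*-identityʳ a)
    const≋scale (suc n) = sym (zeroʳ a)

  charMatrix-⊛ : ∀ {m} (A : Mat m) a j g n →
    (charMatrix A a j ⊛ g) n ≈ (if ⌊ a ≟F j ⌋ then xTimes g n else 0#) - A a j * g n
  charMatrix-⊛ A a j g n = begin
    (charMatrix A a j ⊛ g) n                          ≈⟨ ⊛-distribʳ diag (λ k → - const (A a j) k) g n ⟩
    (diag ⊛ g) n + ((λ k → - const (A a j) k) ⊛ g) n ≈⟨ +-cong (diagonal-⊛ (a ≟F j)) negConst-⊛ ⟩
    (if ⌊ a ≟F j ⌋ then xTimes g n else 0#) - A a j * g n ∎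
    where
    open import Relation.Binary.Reasoning.Setoid setoid
    diag : Series
    diag k = if ⌊ a ≟F j ⌋ then X k else 0#
    diagonal-⊛ : ∀ d → ((λ k → if ⌊ d ⌋ then X k else 0#) ⊛ g) n ≈ (if ⌊ d ⌋ then xTimes g n else 0#)
    diagonal-⊛ (yes _) = X-⊛ g n
    diagonal-⊛ (no _)  = Σ-vanish {suc n} {λ i → 0# * g (n ∸ toℕ i)} (λ i → zeroˡ _)
    negConst-⊛ : ((λ k → - const (A a j) k) ⊛ g) n ≈ - (A a j * g n)
    negConst-⊛ = trans (Σ-cong {suc n} (λ i → sym (-‿distribˡ-* (const (A a j) (toℕ i)) (g (n ∸ toℕ i)))))
      (trans (sym (Σ-neg {suc n} (λ i → const (A a j) (toℕ i) * g (n ∸ toℕ i))))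
             (-‿cong (const-⊛ (A a j) g n)))

  module Adjugate {m : ℕ} (A : Mat (suc m)) where
    χ : Series
    χ = charPoly A

    adjχ : Fin (suc m) → Fin (suc m) → Series
    adjχ = SeriesDet.adj (charMatrix A)

    -- adj(x·I - A) = Σₙ Bₙ xⁿ, and Bₓ n = Bₙ₋₁ (the coefficients of x·adj)
    B Bₓ : ℕ → Mat (suc m)
    B  n i j = adjχ i j n
    Bₓ n i j = xTimes (adjχ i j) n

    -- coefficient n of (x·I - A)·adj(x·I - A) = χ·I
    recurrence : ∀ n → (Bₓ n +M (-M (A *M B n))) ≈M (χ n ·M 1M)
    recurrence n a r = begin
      Bₓ n a r - (A *M B n) a r                                             ≈⟨ +-cong (sym (Σ-δ a (λ j → Bₓ n j r))) (Σ-neg (λ j → A a j * B n j r)) ⟩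
      Σ (λ j → δ a j (Bₓ n j r)) + Σ (λ j → - (A a j * B n j r))           ≈⟨ Σ-+ (λ j → δ a j (Bₓ n j r)) (λ j → - (A a j * B n j r)) ⟨
      Σ (λ j → δ a j (Bₓ n j r) - A a j * B n j r)                         ≈⟨ Σ-cong (λ j → charMatrix-⊛ A a j (adjχ j r) n) ⟨
      Σ (λ j → (charMatrix A a j ⊛ adjχ j r) n)                             ≈⟨ Σ-coeff (λ j → charMatrix A a j ⊛ adjχ j r) n ⟨
      SeriesSum.Σ (λ j → charMatrix A a j ⊛ adjχ j r) n                     ≈⟨ SeriesDet.det-adjugate (charMatrix A) a r n ⟩
      SeriesSum.δ a r χ n                                                   ≈⟨ δ-coeff (a ≟F r) ⟩
      χ n * 1M a r                                                          ∎
      where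
      open import Relation.Binary.Reasoning.Setoid setoid
      δ-coeff : ∀ d → (if ⌊ d ⌋ then χ else (λ _ → 0#)) n ≈ χ n * (if ⌊ d ⌋ then 1# else 0#)
      δ-coeff (yes _) = sym (*-identityʳ _)
      δ-coeff (no _)  = sym (zeroʳ _)

    -- the adjugate entries are m×m minors, of degree ≤ m
    B-top : B (suc m) ≈M 0M
    B-top i j = degree-⊛ 0 m _ _ (degree-sign (toℕ j)) (degree-⊛ 0 m _ _ (degree-sign (toℕ i))
      (degree-det (λ a b → charMatrix A (punchIn j a) (punchIn i b)) (λ a b → charMatrix-degree A _ _)))
      (suc m) ℕ.≤-refl

    module 𝕄 = Ring (matrixRing {suc m})
    open AlgebraOver (matrixAlgebra {suc m})
    open Powers (matrixRing {suc m}) using (_^_)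

    C : ℕ → Mat (suc m)
    C n = χ n ·M 1M

    C-central : ∀ n X → (C n *M X) ≈M (X *M C n)
    C-central n X = 𝕄.trans (·-*ˡ (χ n) 1M X) (𝕄.trans (·-cong refl (𝕄.*-identityˡ X))
      (𝕄.sym (𝕄.trans (·-*ʳ (χ n) X 1M) (·-cong refl (𝕄.*-identityʳ X)))))

    module T = Telescoping.Telescope matrixRing A B Bₓ C recurrence (λ i j → refl) (λ n i j → refl)
      (λ n k → C-central n (A ^ k))

    -- with χ = x^{m+1}:  A^{m+1} = Σ_{n ≤ m+1} χₙAⁿ = -A^{m+2}·B_{m+1} = 0
    power-vanishes : CharPolyIsXPow A → (A ^ suc m) ≈M 0M
    power-vanishes χ≈x^m+1 = begin
      A ^ suc m                                  ≈⟨ 𝕄.*-identityˡ _ ⟨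
      1M *M (A ^ suc m)                          ≈⟨ 𝕄.*-congʳ {A ^ suc m} C-top ⟨
      C (suc m) *M (A ^ suc m)                   ≈⟨ 𝕄.+-identityˡ _ ⟨
      0M +M (C (suc m) *M (A ^ suc m))           ≈⟨ 𝕄.+-congʳ (lower-vanish m ℕ.≤-refl) ⟨
      T.partialSum (suc m)                       ≈⟨ T.telescope (suc m) ⟩
      -M ((A ^ suc (suc m)) *M B (suc m))        ≈⟨ 𝕄.-‿cong (𝕄.*-congˡ {A ^ suc (suc m)} B-top) ⟩
      -M ((A ^ suc (suc m)) *M 0M)               ≈⟨ 𝕄.-‿cong (𝕄.zeroʳ (A ^ suc (suc m))) ⟩
      -M 0M                                      ≈⟨ RingLemmas.-0#≈0# matrixRing ⟩
      0M                                         ∎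
      where
      open import Relation.Binary.Reasoning.Setoid 𝕄.setoid
      C-lower : ∀ n → n ≢ suc m → C n ≈M 0M
      C-lower n n≢m+1 i j = *-vanishˡ (trans (χ≈x^m+1 n) (reflexive (if-≟-no n≢m+1)))
      C-top : C (suc m) ≈M 1M
      C-top i j = trans (*-congʳ (trans (χ≈x^m+1 (suc m)) (reflexive (if-≟-yes (suc m))))) (*-identityˡ _)
      lower-vanish : ∀ N → N ≤ m → T.partialSum N ≈M 0M
      lower-vanish zero    _    = C-lower 0 (λ ())
      lower-vanish (suc N) N+1≤m = 𝕄.trans (𝕄.+-cong (lower-vanish N (ℕ.≤-trans (ℕ.n≤1+n N) N+1≤m))
        (𝕄.trans (𝕄.*-congʳ {A ^ suc N} (C-lower (suc N) (λ N+1≡m+1 → ℕ.<-irrefl N+1≡m+1 (s≤s N+1≤m)))) (𝕄.zeroˡ (A ^ suc N))))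
        (𝕄.+-identityʳ 0M)

  nilpotent : ∀ {m} (A : Mat m) → CharPolyIsXPow A → (A ^M m) ≈M 0M
  nilpotent {zero}  A _ ()
  nilpotent {suc m} A χ≈x^m = ≡.subst (_≈M 0M) (≡.sym (^M≡^ A (suc m))) (Adjugate.power-vanishes A χ≈x^m)

module ExpCoefficients {c ℓ} (R : CommutativeRing c ℓ) where
  open CommutativeRing R hiding (zero)
  open CommutativeRingLemmas R
  open Sums ring
  open PowerSeries R
  open import Relation.Binary.Reasoning.Setoid setoid

  nat : ℕ → Carrier
  nat = fromℕ rawRing

  sign : ℕ → Carrier
  sign = sgn rawRing

  nat-+ : ∀ a b → nat (a ℕ.+ b) ≈ nat a + nat b
  nat-+ zero    b = sym (+-identityˡ _)
  nat-+ (suc a) b = trans (+-congˡ (nat-+ a b)) (sym (+-assoc _ _ _))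

  nat-* : ∀ a b → nat (a ℕ.* b) ≈ nat a * nat b
  nat-* zero    b = sym (zeroˡ _)
  nat-* (suc a) b = begin
    nat (b ℕ.+ a ℕ.* b)          ≈⟨ nat-+ b (a ℕ.* b) ⟩
    nat b + nat (a ℕ.* b)        ≈⟨ +-congˡ (nat-* a b) ⟩
    nat b + nat a * nat b        ≈⟨ +-congʳ (*-identityˡ _) ⟨
    1# * nat b + nat a * nat b   ≈⟨ distribʳ _ _ _ ⟨
    (1# + nat a) * nat b         ∎

  inverse-unique : ∀ {a b x} → a * x ≈ 1# → b * x ≈ 1# → a ≈ b
  inverse-unique {a} {b} {x} ax≈1 bx≈1 = begin
    a             ≈⟨ *-identityʳ a ⟨
    a * 1#        ≈⟨ *-congˡ bx≈1 ⟨
    a * (b * x)   ≈⟨ *-congˡ (*-comm b x) ⟩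
    a * (x * b)   ≈⟨ *-assoc _ _ _ ⟨
    (a * x) * b   ≈⟨ *-congʳ ax≈1 ⟩
    1# * b        ≈⟨ *-identityˡ b ⟩
    b             ∎

  module Truncated (m : ℕ) (u : Fin m → Carrier) (u-inv : ∀ k → u k * nat (toℕ k !) ≈ 1#) where

    e : ℕ → Carrier
    e n with n ℕ.<? m
    ... | yes n<m = u (fromℕ< n<m)
    ... | no _    = 0#

    e-< : ∀ n (n<m : n < m) → e n ≡ u (fromℕ< n<m)
    e-< n n<m with n ℕ.<? m
    ... | yes n<m′ = ≡.cong u (fromℕ<-cong n n ≡.refl n<m′ n<m)
    ... | no n≮m   = ⊥-elim (n≮m n<m)

    e-inverse : ∀ n → n < m → e n * nat (n !) ≈ 1#
    e-inverse n n<m rewrite e-< n n<m =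
      ≡.subst (λ k → u (fromℕ< n<m) * nat (k !) ≈ 1#) (toℕ-fromℕ< n<m) (u-inv (fromℕ< n<m))

    e-toℕ : ∀ k → e (toℕ k) ≈ u k
    e-toℕ k = reflexive (≡.trans (e-< (toℕ k) (toℕ<n k)) (≡.cong u (fromℕ<-toℕ k (toℕ<n k))))

    e-step : ∀ n → suc n < m → nat (suc n) * e (suc n) ≈ e n
    e-step n n+1<m = inverse-unique inverse (e-inverse n (ℕ.<-trans (ℕ.n<1+n n) n+1<m))
      where
      inverse : (nat (suc n) * e (suc n)) * nat (n !) ≈ 1#
      inverse = begin
        (nat (suc n) * e (suc n)) * nat (n !)  ≈⟨ *-congʳ (*-comm _ _) ⟩
        (e (suc n) * nat (suc n)) * nat (n !)  ≈⟨ *-assoc _ _ _ ⟩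
        e (suc n) * (nat (suc n) * nat (n !))  ≈⟨ *-congˡ (nat-* (suc n) (n !)) ⟨
        e (suc n) * nat (suc n !)              ≈⟨ e-inverse (suc n) n+1<m ⟩
        1#                                     ∎

    nat-invertible : ∀ n → suc n < m → (e (suc n) * nat (n !)) * nat (suc n) ≈ 1#
    nat-invertible n n+1<m = begin
      (e (suc n) * nat (n !)) * nat (suc n)  ≈⟨ *-assoc _ _ _ ⟩
      e (suc n) * (nat (n !) * nat (suc n))  ≈⟨ *-congˡ (*-comm _ _) ⟩
      e (suc n) * (nat (suc n) * nat (n !))  ≈⟨ *-congˡ (nat-* (suc n) (n !)) ⟨
      e (suc n) * nat (suc n !)              ≈⟨ e-inverse (suc n) n+1<m ⟩
      1#                                     ∎

    e-0 : 0 < m → e 0 ≈ 1#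
    e-0 0<m = trans (sym (*-identityʳ _)) (trans (*-congˡ (sym (+-identityʳ 1#))) (e-inverse 0 0<m))

    e-1 : 1 < m → e 1 ≈ 1#
    e-1 1<m = trans (sym (*-identityʳ _)) (trans (*-congˡ (sym (+-identityʳ 1#))) (e-inverse 1 1<m))

    ē : ℕ → Carrier
    ē k = sign k * e k

    ē⊛e-0 : 0 < m → (ē ⊛ e) 0 ≈ 1#
    ē⊛e-0 0<m = trans (⊛-const ē e) (trans (*-cong (trans (*-identityˡ _) (e-0 0<m)) (e-0 0<m)) (*-identityˡ 1#))

    -- Multiplying the (n+1)-th coefficient of exp(-x)·exp(x) by n+1 and
    -- splitting n+1 = i + (n+1-i) in its i-th summand gives -c + c where c
    -- is the n-th coefficient; as n+1 is invertible, the coefficient is 0.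
    module _ (n : ℕ) (n+1<m : suc n < m) where
      private
        summand : Fin (suc (suc n)) → Carrier
        summand i = ē (toℕ i) * e (suc n ∸ toℕ i)

        summandₙ : Fin (suc n) → Carrier
        summandₙ i = ē (toℕ i) * e (n ∸ toℕ i)

      weighted-left : Σ (λ i → nat (toℕ i) * summand i) ≈ - (ē ⊛ e) n
      weighted-left = trans (+-vanishˡ (zeroˡ _)) (trans (Σ-cong shiftDown) (sym (Σ-neg summandₙ)))
        where
        shiftDown : ∀ i → nat (suc (toℕ i)) * summand (suc i) ≈ - summandₙ i
        shiftDown i = begin
          nat (suc t) * ((sign (suc t) * e (suc t)) * e (n ∸ t))  ≈⟨ *-assoc _ _ _ ⟨
          (nat (suc t) * (sign (suc t) * e (suc t))) * e (n ∸ t)  ≈⟨ *-congʳ (*-exchange _ _ _) ⟩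
          (sign (suc t) * (nat (suc t) * e (suc t))) * e (n ∸ t)  ≈⟨ *-congʳ (*-congˡ (e-step t t+1<m)) ⟩
          ((- sign t) * e t) * e (n ∸ t)                          ≈⟨ *-congʳ (-‿distribˡ-* _ _) ⟨
          (- (sign t * e t)) * e (n ∸ t)                          ≈⟨ -‿distribˡ-* _ _ ⟨
          - summandₙ i                                            ∎
          where
          t = toℕ i
          t+1<m = ℕ.≤-<-trans (toℕ<n i) n+1<m

      weighted-right : Σ (λ i → nat (suc n ∸ toℕ i) * summand i) ≈ (ē ⊛ e) n
      weighted-right = trans (Σ-last g) (trans (+-vanishʳ last-vanishes) (Σ-cong earlier))
        where
        g : Fin (suc (suc n)) → Carrier
        g i = nat (suc n ∸ toℕ i) * summand i
        step : ∀ t → t ≤ n → nat (suc n ∸ t) * (ē t * e (suc n ∸ t)) ≈ ē t * e (n ∸ t)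
        step t t≤n = ≡.subst (λ k → nat k * (ē t * e k) ≈ ē t * e (n ∸ t)) (≡.sym (ℕ.+-∸-assoc 1 t≤n))
          (trans (*-exchange _ _ _) (*-congˡ (e-step (n ∸ t) (ℕ.≤-<-trans (s≤s (ℕ.m∸n≤m n t)) n+1<m))))
        earlier : ∀ i → g (inject₁ i) ≈ summandₙ i
        earlier i = ≡.subst (λ k → nat (suc n ∸ k) * (ē k * e (suc n ∸ k)) ≈ summandₙ i) (≡.sym (toℕ-inject₁ i))
          (step (toℕ i) (ℕ.≤-pred (toℕ<n i)))
        last-vanishes : g (lastFin (suc n)) ≈ 0#
        last-vanishes = *-vanishˡ (reflexive (≡.cong nat
          (≡.trans (≡.cong (suc n ∸_) (toℕ-fromℕ (suc n))) (ℕ.n∸n≡0 (suc n)))))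

      ē⊛e-suc : (ē ⊛ e) (suc n) ≈ 0#
      ē⊛e-suc = begin
        (ē ⊛ e) (suc n)                      ≈⟨ *-identityˡ _ ⟨
        1# * (ē ⊛ e) (suc n)                 ≈⟨ *-congʳ (nat-invertible n n+1<m) ⟨
        (w * nat (suc n)) * (ē ⊛ e) (suc n)  ≈⟨ *-assoc _ _ _ ⟩
        w * (nat (suc n) * (ē ⊛ e) (suc n))  ≈⟨ *-vanishʳ weighted ⟩
        0#                                   ∎
        where
        w = e (suc n) * nat (n !)
        splitWeight : ∀ i → nat (suc n) ≈ nat (toℕ i) + nat (suc n ∸ toℕ i)
        splitWeight i = trans (reflexive (≡.cong nat (≡.sym (ℕ.m+[n∸m]≡n (ℕ.≤-pred (toℕ<n i))))))
                              (nat-+ (toℕ i) (suc n ∸ toℕ i))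
        weighted : nat (suc n) * (ē ⊛ e) (suc n) ≈ 0#
        weighted = begin
          nat (suc n) * Σ summand
            ≈⟨ Σ-*ˡ (nat (suc n)) summand ⟩
          Σ (λ i → nat (suc n) * summand i)
            ≈⟨ Σ-cong (λ i → trans (*-congʳ (splitWeight i)) (distribʳ (summand i) _ _)) ⟩
          Σ (λ i → nat (toℕ i) * summand i + nat (suc n ∸ toℕ i) * summand i)
            ≈⟨ Σ-+ (λ i → nat (toℕ i) * summand i) (λ i → nat (suc n ∸ toℕ i) * summand i) ⟩
          Σ (λ i → nat (toℕ i) * summand i) + Σ (λ i → nat (suc n ∸ toℕ i) * summand i)
            ≈⟨ +-cong weighted-left weighted-right ⟩
          - (ē ⊛ e) n + (ē ⊛ e) n
            ≈⟨ -‿inverseˡ _ ⟩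
          0# ∎

-- When X^m = 0 this is a
-- ring homomorphism R[[x]] → 𝕄 (eval-⊛), and it commutes with conjugation.
module Evaluation {c ℓ c' ℓ'} {R : CommutativeRing c ℓ} {𝕄 : Ring c' ℓ'} (alg : AlgebraOver R 𝕄) where
  private module R = CommutativeRing R
  open Ring 𝕄 hiding (zero)
  open RingLemmas 𝕄
  open Sums 𝕄
  open Powers 𝕄
  open AlgebraOver alg
  open PowerSeries R
  open import Relation.Binary.Reasoning.Setoid setoid

  ·-zeroˡ : ∀ x → R.0# · x ≈ 0#
  ·-zeroˡ x = x+x≈x⇒x≈0 _ (trans (sym (·-distribʳ R.0# R.0# x)) (·-cong (R.+-identityʳ R.0#) refl))

  ·-zeroʳ : ∀ r → r · 0# ≈ 0#
  ·-zeroʳ r = x+x≈x⇒x≈0 _ (trans (sym (·-distribˡ r 0# 0#)) (·-cong R.refl (+-identityʳ 0#)))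

  ·-negˡ : ∀ r x → (R.- r) · x ≈ - (r · x)
  ·-negˡ r x = +-inverseˡ-unique _ _ (trans (sym (·-distribʳ (R.- r) r x)) (trans (·-cong (R.-‿inverseˡ r) refl) (·-zeroˡ x)))

  ·-negʳ : ∀ r x → r · (- x) ≈ - (r · x)
  ·-negʳ r x = +-inverseˡ-unique _ _ (trans (sym (·-distribˡ r (- x) x)) (trans (·-cong R.refl (-‿inverseˡ x)) (·-zeroʳ r)))

  Σ-· : ∀ {n} r (f : Fin n → Carrier) → r · Σ f ≈ Σ (λ i → r · f i)
  Σ-· {zero}  r f = ·-zeroʳ r
  Σ-· {suc n} r f = trans (·-distribˡ r _ _) (+-congˡ (Σ-· r (λ i → f (suc i))))

  eval : ℕ → Carrier → Series → Carrier
  eval m X p = Σ {m} (λ k → p (toℕ k) · X ^ toℕ k)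

  eval-cong : ∀ m X {p q} → p ≋ q → eval m X p ≈ eval m X q
  eval-cong m X p≋q = Σ-cong {m} (λ k → ·-cong (p≋q (toℕ k)) refl)

  eval-congˡ : ∀ m {X Y} p → X ≈ Y → eval m X p ≈ eval m Y p
  eval-congˡ m p X≈Y = Σ-cong {m} (λ k → ·-cong R.refl (^-congˡ (toℕ k) X≈Y))

  eval-⊕ : ∀ m X p q → eval m X (p ⊕ q) ≈ eval m X p + eval m X q
  eval-⊕ m X p q = trans (Σ-cong {m} (λ k → ·-distribʳ _ _ _))
    (Σ-+ {m} (λ k → p (toℕ k) · X ^ toℕ k) (λ k → q (toℕ k) · X ^ toℕ k))

  eval-scale : ∀ m X a p → eval m X (scale a p) ≈ a · eval m X p
  eval-scale m X a p = trans (Σ-cong {m} (λ k → ·-assoc _ _ _)) (sym (Σ-· {m} a (λ k → p (toℕ k) · X ^ toℕ k)))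

  -- eval m X p is a polynomial in X, so commutes with X and its powers
  eval-commute : ∀ m X p → eval m X p * X ≈ X * eval m X p
  eval-commute m X p = begin
    eval m X p * X                          ≈⟨ Σ-*ʳ {m} X (λ k → p (toℕ k) · X ^ toℕ k) ⟩
    Σ {m} (λ k → (p (toℕ k) · X ^ toℕ k) * X) ≈⟨ Σ-cong {m} (λ k → trans (·-*ˡ _ _ _) (trans (·-cong R.refl (^-commute X (toℕ k))) (sym (·-*ʳ _ _ _)))) ⟩
    Σ {m} (λ k → X * (p (toℕ k) · X ^ toℕ k)) ≈⟨ Σ-*ˡ {m} X (λ k → p (toℕ k) · X ^ toℕ k) ⟨
    X * eval m X p                          ∎

  eval-commute^ : ∀ m X p k → eval m X p * X ^ k ≈ X ^ k * eval m X p
  eval-commute^ m X p zero    = trans (*-identityʳ _) (sym (*-identityˡ _))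
  eval-commute^ m X p (suc k) = begin
    E * (X * X ^ k)   ≈⟨ *-assoc _ _ _ ⟨
    (E * X) * X ^ k   ≈⟨ *-congʳ (eval-commute m X p) ⟩
    (X * E) * X ^ k   ≈⟨ *-assoc _ _ _ ⟩
    X * (E * X ^ k)   ≈⟨ *-congˡ (eval-commute^ m X p k) ⟩
    X * (X ^ k * E)   ≈⟨ *-assoc _ _ _ ⟨
    (X * X ^ k) * E   ∎
    where E = eval m X p

  module Conjugation (J J' : Carrier) (JJ'≈1 : J * J' ≈ 1#) (J'J≈1 : J' * J ≈ 1#) where

    ^-conj : ∀ X k → (J' * (X * J)) ^ k ≈ J' * (X ^ k * J)
    ^-conj X zero    = sym (trans (*-congˡ (*-identityˡ J)) J'J≈1)
    ^-conj X (suc k) = begin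
      (J' * (X * J)) * (J' * (X * J)) ^ k   ≈⟨ *-congˡ (^-conj X k) ⟩
      (J' * (X * J)) * (J' * (X ^ k * J))   ≈⟨ *-assoc _ _ _ ⟩
      J' * ((X * J) * (J' * (X ^ k * J)))   ≈⟨ *-congˡ (*-assoc _ _ _) ⟩
      J' * (X * (J * (J' * (X ^ k * J))))   ≈⟨ *-congˡ (*-congˡ (*-assoc _ _ _)) ⟨
      J' * (X * ((J * J') * (X ^ k * J)))   ≈⟨ *-congˡ (*-congˡ (trans (*-congʳ JJ'≈1) (*-identityˡ _))) ⟩
      J' * (X * (X ^ k * J))                ≈⟨ *-congˡ (*-assoc _ _ _) ⟨
      J' * ((X * X ^ k) * J)                ∎

    eval-conj : ∀ m X p → eval m (J' * (X * J)) p ≈ J' * (eval m X p * J)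
    eval-conj m X p = begin
      Σ {m} (λ k → p (toℕ k) · (J' * (X * J)) ^ toℕ k)   ≈⟨ Σ-cong {m} (λ k → ·-cong R.refl (^-conj X (toℕ k))) ⟩
      Σ {m} (λ k → p (toℕ k) · (J' * (X ^ toℕ k * J)))   ≈⟨ Σ-cong {m} (λ k → trans (sym (·-*ʳ _ _ _)) (*-congˡ (sym (·-*ˡ _ _ _)))) ⟩
      Σ {m} (λ k → J' * ((p (toℕ k) · X ^ toℕ k) * J))   ≈⟨ Σ-*ˡ {m} J' (λ k → (p (toℕ k) · X ^ toℕ k) * J) ⟨
      J' * Σ {m} (λ k → (p (toℕ k) · X ^ toℕ k) * J)     ≈⟨ *-congˡ (Σ-*ʳ {m} J (λ k → p (toℕ k) · X ^ toℕ k)) ⟨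
      J' * (eval m X p * J)                             ∎

  module Nilpotent (m' : ℕ) (X : Carrier) (X^m≈0 : X ^ suc m' ≈ 0#) where
    m = suc m'

    ev : Series → Carrier
    ev = eval m X

    ^-vanish : ∀ j → m ≤ j → X ^ j ≈ 0#
    ^-vanish j m≤j = begin
      X ^ j                   ≡⟨ ≡.cong (X ^_) (≡.sym (ℕ.m+[n∸m]≡n m≤j)) ⟩
      X ^ (m ℕ.+ (j ℕ.∸ m))   ≈⟨ ^-homo-* X m _ ⟩
      X ^ m * X ^ (j ℕ.∸ m)   ≈⟨ *-vanishˡ X^m≈0 ⟩
      0#                      ∎

    ^-distrib : ∀ j a b → X ^ j * (a + X * b) ≈ X ^ j * a + X ^ suc j * b
    ^-distrib j a b = trans (distribˡ _ _ _) (+-congˡ (trans (sym (*-assoc _ _ _)) (*-congʳ (^-commute X j))))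

    ev-horner : ∀ p → ev p ≈ (p 0 · 1#) + X * ev (shift p)
    ev-horner p = +-congˡ (sym shifted)
      where
      h : Fin m → Carrier
      h k = p (suc (toℕ k)) · X ^ suc (toℕ k)
      shifted : X * ev (shift p) ≈ Σ {m'} (λ k → p (suc (toℕ k)) · X ^ suc (toℕ k))
      shifted = begin
        X * ev (shift p)                     ≈⟨ Σ-*ˡ {m} X (λ k → shift p (toℕ k) · X ^ toℕ k) ⟩
        Σ {m} (λ k → X * (shift p (toℕ k) · X ^ toℕ k)) ≈⟨ Σ-cong {m} {_} {h} (λ k → ·-*ʳ _ _ _) ⟩
        Σ {m} h                              ≈⟨ Σ-last h ⟩
        Σ {m'} (λ k → h (inject₁ k)) + h (lastFin m')
          ≈⟨ +-vanishʳ (trans (reflexive (≡.cong (λ t → p (suc t) · X ^ suc t) (toℕ-fromℕ m')))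
                              (trans (·-cong R.refl X^m≈0) (·-zeroʳ _))) ⟩
        Σ {m'} (λ k → h (inject₁ k))         ≈⟨ Σ-cong {m'} (λ k → reflexive (≡.cong (λ t → p (suc t) · X ^ suc t) (toℕ-inject₁ k))) ⟩
        Σ {m'} (λ k → p (suc (toℕ k)) · X ^ suc (toℕ k)) ∎

    ev-horner-⊛ : ∀ p q → ev (p ⊛ q) ≈ (p 0 · ev q) + X * ev (shift p ⊛ q)
    ev-horner-⊛ p q = begin
      ev (p ⊛ q)                                                ≈⟨ ev-horner (p ⊛ q) ⟩
      ((p ⊛ q) 0 · 1#) + X * ev (shift (p ⊛ q))
        ≈⟨ +-cong (·-cong (⊛-const p q) refl)
                  (*-congˡ (eval-cong m X {shift (p ⊛ q)} {scale (p 0) (shift q) ⊕ (shift p ⊛ q)} (λ n → R.refl))) ⟩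
      (R._*_ (p 0) (q 0) · 1#) + X * ev (scale (p 0) (shift q) ⊕ (shift p ⊛ q))
        ≈⟨ +-cong (·-assoc _ _ _) (*-congˡ (trans (eval-⊕ m X (scale (p 0) (shift q)) (shift p ⊛ q))
                                                  (+-congʳ (eval-scale m X (p 0) (shift q))))) ⟩
      (p 0 · (q 0 · 1#)) + X * ((p 0 · ev (shift q)) + ev (shift p ⊛ q))
        ≈⟨ +-congˡ (distribˡ _ _ _) ⟩
      (p 0 · (q 0 · 1#)) + (X * (p 0 · ev (shift q)) + X * ev (shift p ⊛ q))
        ≈⟨ +-assoc _ _ _ ⟨
      ((p 0 · (q 0 · 1#)) + X * (p 0 · ev (shift q))) + X * ev (shift p ⊛ q)
        ≈⟨ +-congʳ (+-congˡ (·-*ʳ _ _ _)) ⟩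
      ((p 0 · (q 0 · 1#)) + (p 0 · (X * ev (shift q)))) + X * ev (shift p ⊛ q)
        ≈⟨ +-congʳ (sym (·-distribˡ _ _ _)) ⟩
      (p 0 · ((q 0 · 1#) + X * ev (shift q))) + X * ev (shift p ⊛ q)
        ≈⟨ +-congʳ (·-cong R.refl (ev-horner q)) ⟨
      (p 0 · ev q) + X * ev (shift p ⊛ q)                       ∎

    ev-horner-* : ∀ p q → ev p * ev q ≈ (p 0 · ev q) + X * (ev (shift p) * ev q)
    ev-horner-* p q = begin
      ev p * ev q                                          ≈⟨ *-congʳ (ev-horner p) ⟩
      ((p 0 · 1#) + X * ev (shift p)) * ev q               ≈⟨ distribʳ _ _ _ ⟩
      (p 0 · 1#) * ev q + (X * ev (shift p)) * ev q        ≈⟨ +-cong (trans (·-*ˡ _ _ _) (·-cong R.refl (*-identityˡ _))) (*-assoc _ _ _) ⟩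
      (p 0 · ev q) + X * (ev (shift p) * ev q)             ∎

    -- X^j·(pq)(X) ≈ X^j·p(X)q(X), by induction on the distance d from j to m
    ev-⊛-from : ∀ d j → m ≤ j ℕ.+ d → ∀ p q → X ^ j * ev (p ⊛ q) ≈ X ^ j * (ev p * ev q)
    ev-⊛-from zero j m≤j p q = trans (*-vanishˡ Xʲ≈0) (sym (*-vanishˡ Xʲ≈0))
      where Xʲ≈0 = ^-vanish j (≡.subst (m ≤_) (ℕ.+-identityʳ j) m≤j)
    ev-⊛-from (suc d) j m≤j+d+1 p q = begin
      X ^ j * ev (p ⊛ q)                                                ≈⟨ *-congˡ (ev-horner-⊛ p q) ⟩
      X ^ j * ((p 0 · ev q) + X * ev (shift p ⊛ q))                     ≈⟨ ^-distrib j _ _ ⟩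
      X ^ j * (p 0 · ev q) + X ^ suc j * ev (shift p ⊛ q)               ≈⟨ +-congˡ (ev-⊛-from d (suc j) (≡.subst (m ≤_) (ℕ.+-suc j d) m≤j+d+1) (shift p) q) ⟩
      X ^ j * (p 0 · ev q) + X ^ suc j * (ev (shift p) * ev q)          ≈⟨ ^-distrib j _ _ ⟨
      X ^ j * ((p 0 · ev q) + X * (ev (shift p) * ev q))                ≈⟨ *-congˡ (ev-horner-* p q) ⟨
      X ^ j * (ev p * ev q)                                             ∎

    eval-⊛ : ∀ p q → ev (p ⊛ q) ≈ ev p * ev q
    eval-⊛ p q = trans (sym (*-identityˡ _)) (trans (ev-⊛-from m 0 ℕ.≤-refl p q) (*-identityˡ _))

    ev-one : ∀ (T : Series) → T 0 R.≈ R.1# → (∀ k → suc k < m → T (suc k) R.≈ R.0#) → ev T ≈ 1#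
    ev-one T T₀≈1 Tₖ≈0 = trans (+-cong (trans (·-cong T₀≈1 refl) (·-identity 1#))
      (Σ-vanish {m'} (λ k → trans (·-cong (Tₖ≈0 (toℕ k) (s≤s (toℕ<n k))) refl) (·-zeroˡ _)))) (+-identityʳ 1#)

module Exponential {c ℓ c' ℓ'} {R : CommutativeRing c ℓ} {𝕄 : Ring c' ℓ'} (alg : AlgebraOver R 𝕄)
  (m' : ℕ) (u : Fin (suc m') → CommutativeRing.Carrier R)
  (u-inv : ∀ k → CommutativeRing._≈_ R (CommutativeRing._*_ R (u k) (fromℕ (CommutativeRing.rawRing R) (toℕ k !))) (CommutativeRing.1# R))
  where
  private module R = CommutativeRing R
  open Ring 𝕄 hiding (zero)
  open RingLemmas 𝕄
  open Powers 𝕄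
  open AlgebraOver alg
  open PowerSeries R
  open Evaluation alg
  open ExpCoefficients R using (sign)
  open ExpCoefficients.Truncated R (suc m') u u-inv public
  open import Relation.Binary.Reasoning.Setoid setoid

  m = suc m'

  exp : Carrier → Carrier
  exp X = eval m X e

  ^-neg : ∀ X k → (- X) ^ k ≈ sign k · X ^ k
  ^-neg X zero    = sym (·-identity 1#)
  ^-neg X (suc k) = begin
    - X * (- X) ^ k               ≈⟨ *-congˡ (^-neg X k) ⟩
    - X * (sign k · X ^ k)        ≈⟨ ·-*ʳ _ _ _ ⟩
    sign k · (- X * X ^ k)        ≈⟨ ·-cong R.refl (-‿distribˡ-* _ _) ⟨
    sign k · (- (X * X ^ k))      ≈⟨ ·-negʳ _ _ ⟩
    - (sign k · (X * X ^ k))      ≈⟨ ·-negˡ _ _ ⟨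
    (R.- sign k) · (X * X ^ k)    ∎

  exp-neg : ∀ X → exp (- X) ≈ eval m X ē
  exp-neg X = Σ-cong {m} (λ k → trans (·-cong (R.refl {e (toℕ k)}) (^-neg X (toℕ k)))
    (trans (sym (·-assoc _ _ _)) (·-cong (R.*-comm _ _) refl)))
    where open Sums 𝕄

  module _ (X : Carrier) (X^m≈0 : X ^ m ≈ 0#) where
    open Nilpotent m' X X^m≈0 using (eval-⊛; ev-one)

    exp-invˡ : eval m X ē * exp X ≈ 1#
    exp-invˡ = trans (sym (eval-⊛ ē e)) (ev-one (ē ⊛ e) (ē⊛e-0 (s≤s z≤n)) ē⊛e-suc)

    exp-invʳ : exp X * eval m X ē ≈ 1#
    exp-invʳ = trans (sym (eval-⊛ e ē)) (trans (eval-cong m X (⊛-comm e ē)) (ev-one (ē ⊛ e) (ē⊛e-0 (s≤s z≤n)) ē⊛e-suc))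

  -- exp is injective on elements with X^m = 0.  Writing exp Z - 1 = Z·v(Z)
  -- with v = (e - 1)/x, one has (exp Z - 1)^k = Z^k + Z^{k+1}·(…); comparing
  -- these for X and Y shows X^k = Y^k for k = m, m-1, …, 1 in turn.
  module Injectivity (X Y : Carrier) (X^m≈0 : X ^ m ≈ 0#) (Y^m≈0 : Y ^ m ≈ 0#) (expX≈expY : exp X ≈ exp Y) where
    module NX = Nilpotent m' X X^m≈0
    module NY = Nilpotent m' Y Y^m≈0

    tails-agree : ∀ d j → m ≤ j ℕ.+ d → (∀ l → j ≤ l → X ^ l ≈ Y ^ l) →
                  ∀ P → X ^ j * NX.ev P ≈ Y ^ j * NY.ev P
    tails-agree zero j m≤j _ P = trans (*-vanishˡ (NX.^-vanish j m≤j′)) (sym (*-vanishˡ (NY.^-vanish j m≤j′)))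
      where m≤j′ = ≡.subst (m ≤_) (ℕ.+-identityʳ j) m≤j
    tails-agree (suc d) j m≤j+d+1 agree P = begin
      X ^ j * NX.ev P                                           ≈⟨ *-congˡ (NX.ev-horner P) ⟩
      X ^ j * ((P 0 · 1#) + X * NX.ev (shift P))                ≈⟨ NX.^-distrib j _ _ ⟩
      X ^ j * (P 0 · 1#) + X ^ suc j * NX.ev (shift P)
        ≈⟨ +-cong (*-congʳ (agree j ℕ.≤-refl))
                  (tails-agree d (suc j) (≡.subst (m ≤_) (ℕ.+-suc j d) m≤j+d+1) (λ l j<l → agree l (ℕ.<⇒≤ j<l)) (shift P)) ⟩
      Y ^ j * (P 0 · 1#) + Y ^ suc j * NY.ev (shift P)          ≈⟨ NY.^-distrib j _ _ ⟨
      Y ^ j * ((P 0 · 1#) + Y * NY.ev (shift P))                ≈⟨ *-congˡ (NY.ev-horner P) ⟨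
      Y ^ j * NY.ev P                                           ∎

    module _ (1<m : 1 < m) where
      -- v = (e - 1)/x and its powers as series; each has constant term 1
      v : Series
      v = shift e

      v^ : ℕ → Series
      v^ zero    = 1S
      v^ (suc k) = v ⊛ v^ k

      v^-const : ∀ k → v^ k 0 R.≈ R.1#
      v^-const zero    = R.refl
      v^-const (suc k) = R.trans (⊛-const v (v^ k)) (R.trans (R.*-cong (e-1 1<m) (v^-const k)) (R.*-identityˡ R.1#))

      module Leading (Z : Carrier) (Z^m≈0 : Z ^ m ≈ 0#) where
        open Nilpotent m' Z Z^m≈0 hiding (m)

        exp-1 : exp Z - 1# ≈ Z * ev v
        exp-1 = begin
          ev e - 1#                     ≈⟨ +-congʳ (ev-horner e) ⟩
          ((e 0 · 1#) + Z * ev v) - 1#  ≈⟨ +-congʳ (+-congʳ (trans (·-cong (e-0 (s≤s z≤n)) refl) (·-identity 1#))) ⟩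
          (1# + Z * ev v) - 1#          ≈⟨ +-congʳ (+-comm _ _) ⟩
          (Z * ev v + 1#) - 1#          ≈⟨ +-assoc _ _ _ ⟩
          Z * ev v + (1# - 1#)          ≈⟨ +-vanishʳ (-‿inverseʳ 1#) ⟩
          Z * ev v                      ∎

        exp-1^ : ∀ k → (exp Z - 1#) ^ k ≈ Z ^ k * ev (v^ k)
        exp-1^ zero    = sym (trans (*-identityˡ _) (ev-one 1S R.refl (λ k _ → R.refl)))
        exp-1^ (suc k) = begin
          (exp Z - 1#) * (exp Z - 1#) ^ k          ≈⟨ *-cong exp-1 (exp-1^ k) ⟩
          (Z * ev v) * (Z ^ k * ev (v^ k))         ≈⟨ *-assoc _ _ _ ⟩
          Z * (ev v * (Z ^ k * ev (v^ k)))         ≈⟨ *-congˡ (*-assoc _ _ _) ⟨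
          Z * ((ev v * Z ^ k) * ev (v^ k))         ≈⟨ *-congˡ (*-congʳ (eval-commute^ m Z v k)) ⟩
          Z * ((Z ^ k * ev v) * ev (v^ k))         ≈⟨ *-congˡ (*-assoc _ _ _) ⟩
          Z * (Z ^ k * (ev v * ev (v^ k)))         ≈⟨ *-assoc _ _ _ ⟨
          Z ^ suc k * (ev v * ev (v^ k))           ≈⟨ *-congˡ (eval-⊛ v (v^ k)) ⟨
          Z ^ suc k * ev (v^ (suc k))              ∎

        leading : ∀ k → Z ^ k * ev (v^ k) ≈ Z ^ k + Z ^ suc k * ev (shift (v^ k))
        leading k = trans (*-congˡ (ev-horner (v^ k))) (trans (^-distrib k _ _)
          (+-congʳ (trans (*-congˡ (trans (·-cong (v^-const k) refl) (·-identity 1#))) (*-identityʳ _))))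

      module LX = Leading X X^m≈0
      module LY = Leading Y Y^m≈0

      powers-agree : ∀ d k → m ≤ k ℕ.+ d → ∀ l → k ≤ l → X ^ l ≈ Y ^ l
      powers-agree zero k m≤k l k≤l = trans (NX.^-vanish l m≤l) (sym (NY.^-vanish l m≤l))
        where m≤l = ℕ.≤-trans (≡.subst (m ≤_) (ℕ.+-identityʳ k) m≤k) k≤l
      powers-agree (suc d) k m≤k+d+1 l k≤l with ℕ.m≤n⇒m<n∨m≡n k≤l
      ... | inj₁ k<l = powers-agree d (suc k) (≡.subst (m ≤_) (ℕ.+-suc k d) m≤k+d+1) l k<l
      ... | inj₂ ≡.refl = +-cancelʳ _ _ _ (trans (begin
        X ^ k + X ^ suc k * NX.ev (shift (v^ k))  ≈⟨ LX.leading k ⟨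
        X ^ k * NX.ev (v^ k)                      ≈⟨ LX.exp-1^ k ⟨
        (exp X - 1#) ^ k                          ≈⟨ ^-congˡ k (+-congʳ expX≈expY) ⟩
        (exp Y - 1#) ^ k                          ≈⟨ LY.exp-1^ k ⟩
        Y ^ k * NY.ev (v^ k)                      ≈⟨ LY.leading k ⟩
        Y ^ k + Y ^ suc k * NY.ev (shift (v^ k))  ∎) (+-congˡ (sym tails)))
        where
        m≤k+1+d = ≡.subst (m ≤_) (ℕ.+-suc k d) m≤k+d+1
        tails = tails-agree d (suc k) m≤k+1+d (powers-agree d (suc k) m≤k+1+d) (shift (v^ k))

    exp-injective : X ≈ Y
    exp-injective with 1 ℕ.<? m
    ... | yes 1<m = trans (sym (*-identityʳ X)) (trans (powers-agree 1<m m' 1 ℕ.≤-refl 1 ℕ.≤-refl) (*-identityʳ Y))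
    ... | no 1≮m  = trans (degenerate X X^m≈0) (sym (degenerate Y Y^m≈0))
      where
      -- for m = 1 the hypothesis says Z = Z¹ = 0
      degenerate : ∀ Z → Z ^ m ≈ 0# → Z ≈ 0#
      degenerate Z Z^m≈0 = trans (sym (*-identityʳ Z))
        (≡.subst (λ k → Z ^ suc k ≈ 0#) (ℕ.n≤0⇒n≡0 (ℕ.≤-pred (ℕ.≮⇒≥ 1≮m))) Z^m≈0)

-- With C = J⁻¹AᵀJ the left side says C = -A and the right side says
-- exp C = J⁻¹BᵀJ = B⁻¹ = exp(-A); exp is injective on nilpotents.
module SkewIffOrthogonal {c ℓ} (R : CommutativeRing c ℓ) where
  open Over R hiding (_^_)
  open Matrices R

  module Setup (m' : ℕ) (J : Mat (suc m')) (J-inv : IsInvertible J) (A : Mat (suc m'))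
           (A^m≈0 : (A ^M suc m') ≈M 0M) (B : Mat (suc m')) (B≈expA : IsExpOf A B) where
    m = suc m'
    𝕄 = matrixRing {m}
    open Ring 𝕄 using (_+_; _*_; -_; 0#; 1#; _≈_; setoid; refl; sym; trans;
                       *-cong; *-congˡ; *-congʳ; *-assoc; *-identityˡ; *-identityʳ; zeroˡ; zeroʳ; -‿inverseˡ)
    open RingLemmas 𝕄 using (+-inverseˡ-unique; -‿distribʳ-*)
    open Powers 𝕄 using (_^_)
    open import Relation.Binary.Reasoning.Setoid setoid
    private
      module R = CommutativeRing R
      module ΣR = Sums (CommutativeRing.ring R)

    J' : Mat m
    J' = proj₁ J-inv
    JJ'≈1 : J * J' ≈ 1#
    JJ'≈1 = proj₁ (proj₂ J-inv)
    J'J≈1 : J' * J ≈ 1#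
    J'J≈1 = proj₂ (proj₂ J-inv)

    open ExpCoefficients R using (sign)
    open Exponential (matrixAlgebra {m}) m' (proj₁ B≈expA) (proj₁ (proj₂ B≈expA)) hiding (m)
    open Evaluation (matrixAlgebra {m}) using (eval; eval-congˡ; module Conjugation)
    open Conjugation J J' JJ'≈1 J'J≈1

    A^m≈0′ : A ^ m ≈ 0#
    A^m≈0′ = ≡.subst (_≈ 0#) (^M≡^ A m) A^m≈0

    exp-entry : ∀ X i j → exp X i j R.≈ ΣR.Σ {m} (λ k → e (toℕ k) R.* (X ^ toℕ k) i j)
    exp-entry X = Σ-entry {m} {m} (λ k → e (toℕ k) ·M (X ^ toℕ k))

    B≈exp : B ≈ exp A
    B≈exp i j = R.trans (proj₂ (proj₂ B≈expA) i j) (R.sym (R.trans (exp-entry A i j)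
      (ΣR.Σ-cong {m} {λ k → e (toℕ k) R.* (A ^ toℕ k) i j} {λ k → proj₁ B≈expA k R.* (A ^M toℕ k) i j}
        (λ k → R.*-cong (e-toℕ k) (R.reflexive (≡.cong (λ P → P i j) (≡.sym (^M≡^ A (toℕ k)))))))))

    ᵀ-^ : ∀ k → ((A ^ k) ᵀ) ≈ ((A ᵀ) ^ k)
    ᵀ-^ zero    = ᵀ-1M {m}
    ᵀ-^ (suc k) = trans (ᵀ-*M {m} A (A ^ k)) (trans (*-congʳ {A ᵀ} (ᵀ-^ k)) (Powers.^-commute 𝕄 (A ᵀ) k))

    Bᵀ≈exp : (B ᵀ) ≈ exp (A ᵀ)
    Bᵀ≈exp i j = R.trans (B≈exp j i) (R.trans (exp-entry A j i) (R.sym (R.trans (exp-entry (A ᵀ) i j)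
      (ΣR.Σ-cong {m} {λ k → e (toℕ k) R.* ((A ᵀ) ^ toℕ k) i j} {λ k → e (toℕ k) R.* (A ^ toℕ k) j i}
        (λ k → R.*-congˡ (R.sym (ᵀ-^ (toℕ k) i j)))))))

    C : Mat m
    C = J' * ((A ᵀ) * J)

    expC : exp C ≈ J' * ((B ᵀ) * J)
    expC = trans (eval-conj m (A ᵀ) e) (*-congˡ {J'} (*-congʳ {J} (sym Bᵀ≈exp)))

    C^m≈0 : C ^ m ≈ 0#
    C^m≈0 = begin
      C ^ m                         ≈⟨ ^-conj (A ᵀ) m ⟩
      J' * (((A ᵀ) ^ m) * J)        ≈⟨ *-congˡ {J'} (*-congʳ {J} (trans (sym (ᵀ-^ m)) (λ i j → A^m≈0′ j i))) ⟩
      J' * (0# * J)                 ≈⟨ *-congˡ {J'} (zeroˡ J) ⟩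
      J' * 0#                       ≈⟨ zeroʳ J' ⟩
      0#                            ∎

    -A^m≈0 : (- A) ^ m ≈ 0#
    -A^m≈0 = trans (^-neg A m) (trans (λ i j → R.*-congˡ (A^m≈0′ i j)) (Evaluation.·-zeroʳ (matrixAlgebra {m}) (sign m)))

    cancelJ : ∀ X → J * (J' * X) ≈ X
    cancelJ X = trans (sym (*-assoc J J' X)) (trans (*-congʳ {X} JJ'≈1) (*-identityˡ X))

    cancelJ' : ∀ X → J' * (J * X) ≈ X
    cancelJ' X = trans (sym (*-assoc J' J X)) (trans (*-congʳ {X} J'J≈1) (*-identityˡ X))

    skew⇒C≈-A : (A ᵀ) * J + J * A ≈ 0# → C ≈ - A
    skew⇒C≈-A skew = begin
      J' * ((A ᵀ) * J)        ≈⟨ *-congˡ {J'} (+-inverseˡ-unique ((A ᵀ) * J) (J * A) skew) ⟩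
      J' * (- (J * A))        ≈⟨ -‿distribʳ-* J' (J * A) ⟨
      - (J' * (J * A))        ≈⟨ Ring.-‿cong 𝕄 (cancelJ' A) ⟩
      - A                     ∎

    C≈-A⇒skew : C ≈ - A → (A ᵀ) * J + J * A ≈ 0#
    C≈-A⇒skew C≈-A = begin
      (A ᵀ) * J + J * A       ≈⟨ Ring.+-congʳ 𝕄 {J * A} AᵀJ≈-JA ⟩
      - (J * A) + J * A       ≈⟨ -‿inverseˡ (J * A) ⟩
      0#                      ∎
      where
      AᵀJ≈-JA : (A ᵀ) * J ≈ - (J * A)
      AᵀJ≈-JA = begin
        (A ᵀ) * J             ≈⟨ cancelJ ((A ᵀ) * J) ⟨
        J * C                 ≈⟨ *-congˡ {J} C≈-A ⟩
        J * (- A)             ≈⟨ -‿distribʳ-* J A ⟨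
        - (J * A)             ∎

    forward : (A ᵀ) * J + J * A ≈ 0# → ((B ᵀ) * J) * B ≈ J
    forward skew = begin
      ((B ᵀ) * J) * B         ≈⟨ *-congʳ {B} (cancelJ ((B ᵀ) * J)) ⟨
      (J * (J' * ((B ᵀ) * J))) * B   ≈⟨ *-assoc J (J' * ((B ᵀ) * J)) B ⟩
      J * ((J' * ((B ᵀ) * J)) * B)   ≈⟨ *-congˡ {J} (*-cong (trans (sym expC) (trans (eval-congˡ m e (skew⇒C≈-A skew)) (exp-neg A))) B≈exp) ⟩
      J * (eval m A ē * exp A)       ≈⟨ *-congˡ {J} (exp-invˡ A A^m≈0′) ⟩
      J * 1#                  ≈⟨ *-identityʳ J ⟩
      J                       ∎

    backward : ((B ᵀ) * J) * B ≈ J → (A ᵀ) * J + J * A ≈ 0#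
    backward orthogonal = C≈-A⇒skew (exp-injective C (- A) C^m≈0 -A^m≈0 expC≈exp-A)
      where
      open Injectivity using (exp-injective)
      expC*B≈1 : exp C * B ≈ 1#
      expC*B≈1 = begin
        exp C * B                       ≈⟨ *-congʳ {B} expC ⟩
        (J' * ((B ᵀ) * J)) * B          ≈⟨ *-assoc J' ((B ᵀ) * J) B ⟩
        J' * (((B ᵀ) * J) * B)          ≈⟨ *-congˡ {J'} orthogonal ⟩
        J' * J                          ≈⟨ J'J≈1 ⟩
        1#                              ∎
      -- exp C is a left inverse of B, whose right inverse is exp(-A)
      expC≈exp-A : exp C ≈ exp (- A)
      expC≈exp-A = begin
        exp C                           ≈⟨ *-identityʳ (exp C) ⟨
        exp C * 1#                      ≈⟨ *-congˡ {exp C} (trans (*-congʳ {eval m A ē} B≈exp) (exp-invʳ A A^m≈0′)) ⟨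
        exp C * (B * eval m A ē)        ≈⟨ *-assoc (exp C) B (eval m A ē) ⟨
        (exp C * B) * eval m A ē        ≈⟨ *-congʳ {eval m A ē} expC*B≈1 ⟩
        1# * eval m A ē                 ≈⟨ *-identityˡ _ ⟩
        eval m A ē                      ≈⟨ exp-neg A ⟨
        exp (- A)                       ∎

  skew⇔orthogonal : ∀ m (J : Mat m) → IsInvertible J → (A : Mat m) → (A ^M m) ≈M 0M →
    (B : Mat m) → IsExpOf A B →
    ((((A ᵀ) *M J) +M (J *M A)) ≈M 0M) ⇔ ((((B ᵀ) *M J) *M B) ≈M J)
  skew⇔orthogonal zero    J _ A _ B _ = mk⇔ (λ _ ()) (λ _ ())
  skew⇔orthogonal (suc m') J J-inv A A^m≈0 B B≈expA = mk⇔ forward backward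
    where open Setup m' J J-inv A A^m≈0 B B≈expA

-- Corollary 5.2.
corollary5p2 : ∀ {c₁ ℓ₁ c₂ ℓ₂} (O : CommutativeRing c₁ ℓ₁) → Over.IsDVR O →
    (p : ℕ) → Prime p → Over.ResidueCharIs O p →
    (m : ℕ) → p ≥ m →
    (R : CommutativeRing c₂ ℓ₂) (f : CommutativeRing.Carrier O → CommutativeRing.Carrier R) → IsAlgebraMap O R f →
    (J : Over.Mat R m) → Over.IsInvertible R J → (Over.IsSymmetricPairing R J ⊎ Over.IsAlternatingPairing R J) →
    (A : Over.Mat R m) → Over.CharPolyIsXPow R A →
    (B : Over.Mat R m) → Over.IsExpOf R A B →
    (let open Over R in ((((A ᵀ) *M J) +M (J *M A)) ≈M 0M) ⇔ ((((B ᵀ) *M J) *M B) ≈M J))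
corollary5p2 O _ p _ _ m _ R f _ J J-invertible _ A charPoly≈xᵐ B B≈expA =
  SkewIffOrthogonal.skew⇔orthogonal R m J J-invertible A
    (CayleyHamilton.nilpotent R A charPoly≈xᵐ) B B≈expA
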